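{- There exists $\varepsilon_0>0$ such that the following holds for every $0<\varepsilon\leq\varepsilon_0$, every integer $r\geq 8$ and every positive integer $n$. Let $A\subseteq[n]$ with $|A|=\lceil n/2\rceil+c$ where $1<c\leq\varepsilon n$, and suppose $A=B\cup C$ is a partition with $B\subseteq[\lfloor n/2\rfloor+1,n]$ and $|C|\leq\varepsilon n$. Then (i) if $n$ is even, $g(A,r)<r^{\lceil n/2\rceil+1}$; (ii) if $n$ is odd, $g(A,r)<r^{\lceil n/2\rceil}(3-2/r)$.
   Context: $[m,k]=\{m,\dots,k\}$. An $r$-coloring of $A$ is a map $A\to[r]$; a rainbow sum is a triple of distinct $x,y,z$ with $x+y=z$ colored with three different colors; a coloring is rainbow sum-free if it has no rainbow sum. $g(A,r)$ is the number of rainbow sum-free $r$-colorings of $A$.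
   Formalization: The parameter ε ranges only over the positive rationals, and the constant ε₀ is taken in ℚ. -}

module Defs where

open import Data.Nat using (ℕ; zero; suc; _+_; _≤_; _<_)
open import Data.Nat.Properties using (_≟_)
open import Data.Fin using (Fin)
open import Data.Fin.Properties using (any?) renaming (_≟_ to _≟ᶠ_)
open import Data.Vec using (Vec; []; _∷_; lookup)
open import Data.List using (List; []; _∷_; length; map; concatMap; filter; allFin)
import Data.List as L
open import Data.List.Relation.Unary.All using (All)
open import Data.List.Relation.Unary.Unique.Propositional using (Unique)
open import Data.Product using (Σ; _×_; _,_)
open import Relation.Binary.PropositionalEquality using (_≡_; _≢_)
open import Relation.Nullary using (¬_; Dec; ¬?)
open import Relation.Nullary.Decidable using (_×-dec_)

-- A finite set A ⊆ ℕ is represented by a duplicate-free list of its elements;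
-- an r-colouring of A is a vector of colours aligned with that list
-- (the element  L.lookup A i  gets colour  lookup χ i).

allVecs : (r m : ℕ) → List (Vec (Fin r) m)
allVecs r zero = [] ∷ []
allVecs r (suc m) = concatMap (λ c → map (c ∷_) (allVecs r m)) (allFin r)

RainbowSumAt : (A : List ℕ) {r : ℕ} → Vec (Fin r) (length A) →
               Fin (length A) → Fin (length A) → Fin (length A) → Set
RainbowSumAt A χ i j k =
  (L.lookup A i ≢ L.lookup A j) × (L.lookup A i ≢ L.lookup A k) × (L.lookup A j ≢ L.lookup A k)
  × (L.lookup A i + L.lookup A j ≡ L.lookup A k)
  × (lookup χ i ≢ lookup χ j) × (lookup χ i ≢ lookup χ k) × (lookup χ j ≢ lookup χ k)

HasRainbowSum : (A : List ℕ) {r : ℕ} → Vec (Fin r) (length A) → Set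
HasRainbowSum A χ = Σ (Fin (length A)) λ i → Σ (Fin (length A)) λ j → Σ (Fin (length A)) λ k →
  RainbowSumAt A χ i j k

RainbowSumFree : (A : List ℕ) {r : ℕ} → Vec (Fin r) (length A) → Set
RainbowSumFree A χ = ¬ HasRainbowSum A χ

rainbowSumAt? : (A : List ℕ) {r : ℕ} (χ : Vec (Fin r) (length A)) → ∀ i j k → Dec (RainbowSumAt A χ i j k)
rainbowSumAt? A χ i j k =
  ¬? (L.lookup A i ≟ L.lookup A j) ×-dec ¬? (L.lookup A i ≟ L.lookup A k) ×-dec ¬? (L.lookup A j ≟ L.lookup A k)
  ×-dec (L.lookup A i + L.lookup A j ≟ L.lookup A k)
  ×-dec ¬? (lookup χ i ≟ᶠ lookup χ j) ×-dec ¬? (lookup χ i ≟ᶠ lookup χ k) ×-dec ¬? (lookup χ j ≟ᶠ lookup χ k)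

rainbowSumFree? : (A : List ℕ) {r : ℕ} (χ : Vec (Fin r) (length A)) → Dec (RainbowSumFree A χ)
rainbowSumFree? A χ = ¬? (any? λ i → any? λ j → any? λ k → rainbowSumAt? A χ i j k)

g : List ℕ → ℕ → ℕ
g A r = length (filter (rainbowSumFree? A) (allVecs r (length A)))

InInterval : ℕ → ℕ → List ℕ → Set
InInterval m k A = All (λ x → m ≤ x × x ≤ k) A

-- Let x be the least element of A.  A rainbow-sum-free colouring gives each Schur triple
-- x + y = y + x in A at most two colours, so once the colour of x is fixed, each of p pairwise
-- disjoint pairs {y, y + x} ⊆ A ∖ {x} takes at most 3r − 2 of its r² colourings, and
-- g(A, r) · (r²)^p ≤ r^|A| · (3r − 2)^p.  Such pairs exist with ⌈n/2⌉ + 2c ≤ p + ⌊n/2⌋ + 2.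
-- If 3x ≥ n, take as bases all y ∈ W = (x, n − x]: then A ⊆ {x} ∪ W ∪ (W + x) ∪ (n − x, 2x], so
-- |A| ≤ p + x + 1, while A has at least c elements in [x, ⌊n/2⌋], so x + c ≤ ⌊n/2⌋ + 1.
-- If 3x < n, take the bases from every other block of x consecutive integers above ⌊n/2⌋: this
-- window has at least 2|C| elements (as |C| ≤ n/100), whereas A misses at most |C| − c
-- elements of the upper half, so at least 2c of the pairs lie in A.  Finally (3r − 2)² < r³ for r ≥ 8.

module Submission where

open import Data.Nat hiding (_/_)
open import Data.Nat.Properties
open import Data.Nat.DivMod using (%-distribˡ-+; [m+n]%n≡m%n; m%n<n; m<n⇒m%n≡m)
open import Data.Nat.Tactic.RingSolver using (solve-∀)
open import Data.Bool using (Bool; true; false; _∧_; _∨_; not; T)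
open import Data.Bool.Properties using (∧-zeroʳ; ∧-identityʳ; T-∧)
open import Data.Empty using (⊥; ⊥-elim)
open import Data.Unit using (tt)
open import Data.Sum using (_⊎_; inj₁; inj₂)
open import Data.Product using (Σ; _×_; _,_; proj₁; proj₂; swap)
open import Data.Fin using (Fin; zero; suc; punchOut)
open import Data.Fin.Properties using (punchIn-punchOut; punchOut-injective) renaming (_≟_ to _≟ᶠ_)
open import Data.Vec using (Vec; []; _∷_; lookup; insertAt)
open import Data.Vec.Properties using (insertAt-lookup; insertAt-punchIn)
open import Data.List using (List; []; _∷_; length; map; filter; concatMap; tabulate; _++_; downFrom)
import Data.List as List
open import Data.List.Properties using (filter-++; length-++)
open import Data.List.Extrema ≤-totalOrder using (min; argmin-all; min≤⊤; min≤xs)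
open import Data.List.Relation.Unary.Any using (index; here; there)
open import Data.List.Relation.Unary.Any.Properties using (lookup-index)
open import Data.List.Relation.Unary.All as All using (All; []; _∷_)
open import Data.List.Relation.Unary.All.Properties using (all-filter)
open import Data.List.Relation.Unary.AllPairs as AllPairs using ([]; _∷_)
open import Data.List.Relation.Unary.Unique.Propositional using (Unique)
import Data.List.Relation.Unary.Unique.Propositional.Properties as Unique
open import Data.List.Membership.Propositional using (_∈_)
open import Data.List.Membership.Propositional.Properties using (∈-++⁻)
open import Data.List.Membership.DecPropositional _≟_ using (_∈?_)
open import Data.List.Relation.Binary.Permutation.Propositional using (_↭_)
open import Data.List.Relation.Binary.Permutation.Propositional.Properties using (∈-resp-↭)
open import Function using (_∘_; _$_; id)
open import Function.Bundles using (_⇔_; mk⇔; Equivalence)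
open import Relation.Nullary using (Dec; yes; no; does; ¬_; ¬?; contradiction)
open import Relation.Nullary.Decidable using (T?; _×-dec_; _⊎-dec_; dec-true; dec-false; does-⇔)
open import Relation.Unary using (Decidable)
open import Relation.Binary.PropositionalEquality
open import Algebra.Properties.Semiring.Sum +-*-semiring using (sum-syntax; sum-cong-≗; ∑-comm; ∑-distrib-+; *-distribʳ-sum)
open import Algebra.Properties.CommutativeSemigroup +-commutativeSemigroup using (interchange)
open import Algebra.Properties.CommutativeSemigroup *-commutativeSemigroup using ()
  renaming (interchange to *-interchange; xy∙z≈xz∙y to *-right-comm)

open import Defs

𝟙 : Bool → ℕ
𝟙 true = 1
𝟙 false = 0

𝟙≤1 : ∀ b → 𝟙 b ≤ 1
𝟙≤1 true = ≤-refl
𝟙≤1 false = z≤n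

𝟙-mono : ∀ {a b} {P : Set a} {Q : Set b} (P? : Dec P) (Q? : Dec Q) → (P → Q) → 𝟙 (does P?) ≤ 𝟙 (does Q?)
𝟙-mono (no _) Q? P⇒Q = z≤n
𝟙-mono (yes p) Q? P⇒Q rewrite dec-true Q? (P⇒Q p) = ≤-refl

𝟙-∨-≤ : ∀ a b → 𝟙 (a ∨ b) ≤ 𝟙 a + 𝟙 b
𝟙-∨-≤ true b = s≤s z≤n
𝟙-∨-≤ false b = ≤-refl

𝟙-yes : ∀ {a} {P : Set a} (P? : Dec P) → P → 𝟙 (does P?) ≡ 1
𝟙-yes P? p rewrite dec-true P? p = refl

𝟙-no : ∀ {a} {P : Set a} (P? : Dec P) → ¬ P → 𝟙 (does P?) ≡ 0
𝟙-no P? ¬p rewrite dec-false P? ¬p = refl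

∑-mono : ∀ {n} {f f′ : Fin n → ℕ} → (∀ i → f i ≤ f′ i) → ∑[ i < n ] f i ≤ ∑[ i < n ] f′ i
∑-mono {zero} f≤f′ = z≤n
∑-mono {suc n} f≤f′ = +-mono-≤ (f≤f′ zero) (∑-mono (f≤f′ ∘ suc))

∑-const : ∀ n a → ∑[ i < n ] a ≡ n * a
∑-const zero a = refl
∑-const (suc n) a = cong (a +_) (∑-const n a)

∑-𝟙-≟ᶠ : ∀ {n} (c : Fin n) → ∑[ b < n ] 𝟙 (does (c ≟ᶠ b)) ≡ 1
∑-𝟙-≟ᶠ {suc n} zero = cong suc (trans (∑-const n 0) (*-zeroʳ n))
∑-𝟙-≟ᶠ {suc n} (suc c) = ∑-𝟙-≟ᶠ c

-- Counting over [0, N)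

sumBelow : ℕ → (ℕ → ℕ) → ℕ
sumBelow zero f = 0
sumBelow (suc N) f = f N + sumBelow N f

sumBelow-cong : ∀ N {f f′ : ℕ → ℕ} → (∀ y → y < N → f y ≡ f′ y) → sumBelow N f ≡ sumBelow N f′
sumBelow-cong zero f≗f′ = refl
sumBelow-cong (suc N) f≗f′ = cong₂ _+_ (f≗f′ N ≤-refl) (sumBelow-cong N (λ y y<N → f≗f′ y (m<n⇒m<1+n y<N)))

sumBelow-mono : ∀ N {f f′ : ℕ → ℕ} → (∀ y → y < N → f y ≤ f′ y) → sumBelow N f ≤ sumBelow N f′
sumBelow-mono zero f≤f′ = z≤n
sumBelow-mono (suc N) f≤f′ = +-mono-≤ (f≤f′ N ≤-refl) (sumBelow-mono N (λ y y<N → f≤f′ y (m<n⇒m<1+n y<N)))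

sumBelow-distrib-+ : ∀ N (f f′ : ℕ → ℕ) → sumBelow N (λ y → f y + f′ y) ≡ sumBelow N f + sumBelow N f′
sumBelow-distrib-+ zero f f′ = refl
sumBelow-distrib-+ (suc N) f f′ rewrite sumBelow-distrib-+ N f f′ = interchange (f N) (f′ N) _ _

sumBelow-zero : ∀ N (f : ℕ → ℕ) → (∀ y → y < N → f y ≡ 0) → sumBelow N f ≡ 0
sumBelow-zero zero f f≗0 = refl
sumBelow-zero (suc N) f f≗0 = cong₂ _+_ (f≗0 N ≤-refl) (sumBelow-zero N f (λ y y<N → f≗0 y (m<n⇒m<1+n y<N)))

sumBelow-+ : ∀ M N (f : ℕ → ℕ) → sumBelow (M + N) f ≡ sumBelow M (λ y → f (y + N)) + sumBelow N f
sumBelow-+ zero N f = refl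
sumBelow-+ (suc M) N f rewrite sumBelow-+ M N f = sym (+-assoc (f (M + N)) _ _)

sumBelow-extend : ∀ {M N} (f : ℕ → ℕ) → N ≤ M → sumBelow N f ≤ sumBelow M f
sumBelow-extend {M} {N} f N≤M = begin
  sumBelow N f                                       ≤⟨ m≤n+m _ _ ⟩
  sumBelow (M ∸ N) (λ y → f (y + N)) + sumBelow N f ≡⟨ sumBelow-+ (M ∸ N) N f ⟨
  sumBelow (M ∸ N + N) f                             ≡⟨ cong (λ k → sumBelow k f) (m∸n+n≡m N≤M) ⟩
  sumBelow M f                                       ∎
  where open ≤-Reasoning

count : {P : ℕ → Set} → ℕ → Decidable P → ℕ
count N P? = sumBelow N (λ y → 𝟙 (does (P? y)))

module _ {P Q : ℕ → Set} (P? : Decidable P) (Q? : Decidable Q) where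

  count-cong : ∀ N → (∀ y → y < N → P y ⇔ Q y) → count N P? ≡ count N Q?
  count-cong N P⇔Q = sumBelow-cong N (λ y y<N → cong 𝟙 (does-⇔ (P⇔Q y y<N) (P? y) (Q? y)))

  count-mono : ∀ N → (∀ y → y < N → P y → Q y) → count N P? ≤ count N Q?
  count-mono N P⇒Q = sumBelow-mono N (λ y y<N → 𝟙-mono (P? y) (Q? y) (P⇒Q y y<N))

  count-⊎ : ∀ N → count N (λ y → P? y ⊎-dec Q? y) ≤ count N P? + count N Q?
  count-⊎ N = begin
    count N (λ y → P? y ⊎-dec Q? y)                       ≤⟨ sumBelow-mono N (λ y _ → 𝟙-∨-≤ (does (P? y)) (does (Q? y))) ⟩
    sumBelow N (λ y → 𝟙 (does (P? y)) + 𝟙 (does (Q? y))) ≡⟨ sumBelow-distrib-+ N _ _ ⟩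
    count N P? + count N Q?                                ∎
    where
    open ≤-Reasoning

  count-partition : ∀ N → count N P? ≡ count N (λ y → Q? y ×-dec P? y) + count N (λ y → ¬? (Q? y) ×-dec P? y)
  count-partition N = trans (sumBelow-cong N (λ y _ → 𝟙-partition (does (Q? y)) (does (P? y)))) (sumBelow-distrib-+ N _ _)
    where
    𝟙-partition : ∀ a b → 𝟙 b ≡ 𝟙 (a ∧ b) + 𝟙 (not a ∧ b)
    𝟙-partition true b = sym (+-identityʳ _)
    𝟙-partition false b = refl

  count-⊎-disjoint : ∀ N → (∀ y → P y → Q y → ⊥) →
                     count N (λ y → P? y ⊎-dec Q? y) ≡ count N P? + count N Q?
  count-⊎-disjoint N disjoint =
    trans (sumBelow-cong N (λ y _ → 𝟙-⊎ (P? y) (Q? y) (disjoint y))) (sumBelow-distrib-+ N _ _)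
    where
    𝟙-⊎ : ∀ {A B : Set} (A? : Dec A) (B? : Dec B) → (A → B → ⊥) →
          𝟙 (does (A? ⊎-dec B?)) ≡ 𝟙 (does A?) + 𝟙 (does B?)
    𝟙-⊎ (yes a) (yes b) a∧b = ⊥-elim (a∧b a b)
    𝟙-⊎ (yes a) (no _) _ = refl
    𝟙-⊎ (no _) B? _ = refl

count-extend : ∀ {P : ℕ → Set} (P? : Decidable P) {M N} → N ≤ M → (∀ y → N ≤ y → y < M → ¬ P y) → count M P? ≡ count N P?
count-extend {P} P? {M} {N} N≤M ¬P = begin
  count M P?                                                  ≡⟨ cong (λ k → count k P?) (m∸n+n≡m N≤M) ⟨
  count (M ∸ N + N) P?                                        ≡⟨ sumBelow-+ (M ∸ N) N _ ⟩
  sumBelow (M ∸ N) (λ y → 𝟙 (does (P? (y + N)))) + count N P? ≡⟨ cong (_+ count N P?) (sumBelow-zero _ _ beyond) ⟩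
  count N P?                                                  ∎
  where
  open ≡-Reasoning
  beyond : ∀ y → y < M ∸ N → 𝟙 (does (P? (y + N))) ≡ 0
  beyond y y<M∸N = 𝟙-no (P? (y + N)) (¬P (y + N) (m≤n+m N y) (subst (y + N <_) (m∸n+n≡m N≤M) (+-monoˡ-< N y<M∸N)))

count-inclusion-exclusion : ∀ {P Q R : ℕ → Set} (P? : Decidable P) (Q? : Decidable Q) (R? : Decidable R) N →
  count N (λ y → P? y ×-dec Q? y) + count N (λ y → P? y ×-dec R? y)
    ≤ count N (λ y → P? y ×-dec Q? y ×-dec R? y) + count N P?
count-inclusion-exclusion P? Q? R? N = begin
  count N (λ y → P? y ×-dec Q? y) + count N (λ y → P? y ×-dec R? y) ≡⟨ sumBelow-distrib-+ N _ _ ⟨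
  sumBelow N (λ y → 𝟙 (p y ∧ q y) + 𝟙 (p y ∧ r y))                    ≤⟨ sumBelow-mono N (λ y _ → pointwise (p y) (q y) (r y)) ⟩
  sumBelow N (λ y → 𝟙 (p y ∧ q y ∧ r y) + 𝟙 (p y))                    ≡⟨ sumBelow-distrib-+ N _ _ ⟩
  count N (λ y → P? y ×-dec Q? y ×-dec R? y) + count N P?            ∎
  where
  open ≤-Reasoning
  p q r : ℕ → Bool
  p y = does (P? y)
  q y = does (Q? y)
  r y = does (R? y)
  pointwise : ∀ a b c → 𝟙 (a ∧ b) + 𝟙 (a ∧ c) ≤ 𝟙 (a ∧ b ∧ c) + 𝟙 a
  pointwise false b c = z≤n
  pointwise true true true = ≤-refl
  pointwise true true false = ≤-refl
  pointwise true false true = ≤-refl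
  pointwise true false false = z≤n

count-shift : ∀ {Q : ℕ → Set} (Q? : Decidable Q) N x →
              count (N + x) (λ z → x ≤? z ×-dec Q? (z ∸ x)) ≡ count N Q?
count-shift {Q} Q? N x = begin
  count (N + x) shifted?
    ≡⟨ sumBelow-+ N x _ ⟩
  sumBelow N (λ y → 𝟙 (does (shifted? (y + x)))) + count x shifted?
    ≡⟨ cong₂ _+_ (sumBelow-cong N (λ y _ → above y)) (sumBelow-zero x _ below) ⟩
  count N Q? + 0
    ≡⟨ +-identityʳ _ ⟩
  count N Q? ∎
  where
  open ≡-Reasoning
  shifted? : Decidable (λ z → x ≤ z × Q (z ∸ x))
  shifted? z = x ≤? z ×-dec Q? (z ∸ x)
  above : ∀ y → 𝟙 (does (shifted? (y + x))) ≡ 𝟙 (does (Q? y))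
  above y rewrite dec-true (x ≤? y + x) (m≤n+m x y) | m+n∸n≡m y x = refl
  below : ∀ z → z < x → 𝟙 (does (shifted? z)) ≡ 0
  below z z<x rewrite dec-false (x ≤? z) (<⇒≱ z<x) = refl

count-shift-< : ∀ {Q : ℕ → Set} (Q? : Decidable Q) N x → (∀ {y} → Q y → y + x < N) →
                count N (λ z → x ≤? z ×-dec Q? (z ∸ x)) ≡ count N Q?
count-shift-< {Q} Q? N x fits = trans (sym (count-extend shifted? (m≤m+n N x) beyond)) (count-shift Q? N x)
  where
  shifted? : Decidable (λ z → x ≤ z × Q (z ∸ x))
  shifted? z = x ≤? z ×-dec Q? (z ∸ x)
  beyond : ∀ z → N ≤ z → z < N + x → ¬ (x ≤ z × Q (z ∸ x))
  beyond z N≤z _ (x≤z , Q[z∸x]) = <⇒≱ (subst (_< N) (m∸n+n≡m x≤z) (fits Q[z∸x])) N≤z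

count-interval : ∀ N lo hi → count N (λ y → lo ≤? y ×-dec y <? hi) ≡ N ⊓ hi ∸ lo
count-interval zero lo hi = sym (0∸n≡0 lo)
count-interval (suc N) lo hi with N <? hi
... | no N≮hi rewrite dec-false (N <? hi) N≮hi | count-interval N lo hi
                    | m≥n⇒m⊓n≡n (≮⇒≥ N≮hi) | m≥n⇒m⊓n≡n (m≤n⇒m≤1+n (≮⇒≥ N≮hi)) | ∧-zeroʳ (does (lo ≤? N)) = refl
... | yes N<hi rewrite dec-true (N <? hi) N<hi | count-interval N lo hi
                     | m≤n⇒m⊓n≡m (<⇒≤ N<hi) | m≤n⇒m⊓n≡m N<hi | ∧-identityʳ (does (lo ≤? N)) with lo ≤? N
...   | yes lo≤N = trans (cong (_+ (N ∸ lo)) (𝟙-yes (lo ≤? N) lo≤N)) (sym (+-∸-assoc 1 lo≤N))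
...   | no lo≰N  = trans (cong (_+ (N ∸ lo)) (𝟙-no (lo ≤? N) lo≰N))
                     (trans (m≤n⇒m∸n≡0 (≰⇒≥ lo≰N)) (sym (m≤n⇒m∸n≡0 (≰⇒> lo≰N))))

count-interval-≤ : ∀ N lo hi → hi ≤ N → count N (λ y → lo ≤? y ×-dec y <? hi) ≡ hi ∸ lo
count-interval-≤ N lo hi hi≤N = trans (count-interval N lo hi) (cong (_∸ lo) (m≥n⇒m⊓n≡n hi≤N))

private
  ≡⇔singleton-interval : ∀ {a y} → y ≡ a ⇔ (a ≤ y × y < suc a)
  ≡⇔singleton-interval = mk⇔ (λ { refl → ≤-refl , ≤-refl }) (λ (a≤y , y<1+a) → ≤-antisym (≤-pred y<1+a) a≤y)

count-singleton : ∀ N a → count N (_≟ a) ≡ N ⊓ suc a ∸ a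
count-singleton N a = trans (count-cong (_≟ a) (λ y → a ≤? y ×-dec y <? suc a) N (λ _ _ → ≡⇔singleton-interval))
                            (count-interval N a (suc a))

count-singleton-≤1 : ∀ N a → count N (_≟ a) ≤ 1
count-singleton-≤1 N a = begin
  count N (_≟ a)  ≡⟨ count-singleton N a ⟩
  N ⊓ suc a ∸ a   ≤⟨ ∸-monoˡ-≤ a (m⊓n≤n N (suc a)) ⟩
  suc a ∸ a       ≡⟨ m+n∸n≡m 1 a ⟩
  1               ∎
  where open ≤-Reasoning

count-singleton-≡1 : ∀ {N a} → a < N → count N (_≟ a) ≡ 1
count-singleton-≡1 {N} {a} a<N = trans (count-singleton N a) (trans (cong (_∸ a) (m≥n⇒m⊓n≡n a<N)) (m+n∸n≡m 1 a))

count-∈ : ∀ N {A} → Unique A → All (_< N) A → count N (_∈? A) ≡ length A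
count-∈ N [] [] = sumBelow-zero N _ (λ _ _ → refl)
count-∈ N {a ∷ A} (a∉A ∷ uniq) (a<N ∷ A<N) = begin
  count N (λ y → y ≟ a ⊎-dec y ∈? A)  ≡⟨ count-⊎-disjoint (_≟ a) (_∈? A) N (λ { y refl y∈A → All.lookup a∉A y∈A refl }) ⟩
  count N (_≟ a) + count N (_∈? A)     ≡⟨ cong₂ _+_ (count-singleton-≡1 a<N) (count-∈ N uniq A<N) ⟩
  suc (length A)                        ∎
  where open ≡-Reasoning

count-∈-≤ : ∀ N C → count N (_∈? C) ≤ length C
count-∈-≤ N [] = ≤-reflexive (sumBelow-zero N _ (λ _ _ → refl))
count-∈-≤ N (a ∷ C) = begin
  count N (λ y → y ≟ a ⊎-dec y ∈? C)  ≤⟨ count-⊎ (_≟ a) (_∈? C) N ⟩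
  count N (_≟ a) + count N (_∈? C)     ≤⟨ +-mono-≤ (count-singleton-≤1 N a) (count-∈-≤ N C) ⟩
  suc (length C)                        ∎
  where open ≤-Reasoning

length-filter-downFrom : ∀ {P : ℕ → Set} (P? : Decidable P) N → length (filter P? (downFrom N)) ≡ count N P?
length-filter-downFrom P? zero = refl
length-filter-downFrom P? (suc N) with does (P? N)
... | true = cong suc (length-filter-downFrom P? N)
... | false = length-filter-downFrom P? N

count-complement : ∀ {P : ℕ → Set} (P? : Decidable P) N → count N P? + count N (¬? ∘ P?) ≡ N
count-complement P? zero = refl
count-complement P? (suc N) = begin
  (p + count N P?) + (𝟙 (not (does (P? N))) + count N (¬? ∘ P?)) ≡⟨ interchange p _ _ _ ⟩
  (p + 𝟙 (not (does (P? N)))) + (count N P? + count N (¬? ∘ P?)) ≡⟨ cong₂ _+_ (𝟙-not (does (P? N))) (count-complement P? N) ⟩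
  suc N                                                          ∎
  where
  open ≡-Reasoning
  p : ℕ
  p = 𝟙 (does (P? N))
  𝟙-not : ∀ b → 𝟙 b + 𝟙 (not b) ≡ 1
  𝟙-not true = refl
  𝟙-not false = refl

module LowerHalf (x : ℕ) (0<x : 0 < x) where

  private
    instance
      2x≢0 : NonZero (x + x)
      2x≢0 = >-nonZero (≤-trans 0<x (m≤m+n x x))

    x%2x≡x : x % (x + x) ≡ x
    x%2x≡x = m<n⇒m%n≡m (m<m+n x 0<x)

    [t+x]%2x : ∀ t → (t + x) % (x + x) ≡ (t % (x + x) + x) % (x + x)
    [t+x]%2x t = trans (%-distribˡ-+ t x (x + x)) (cong (λ z → (t % (x + x) + z) % (x + x)) x%2x≡x)

  Low : ℕ → Set
  Low t = t % (x + x) < x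

  low? : Decidable Low
  low? t = t % (x + x) <? x

  low⇒high+x : ∀ t → Low t → ¬ Low (t + x)
  low⇒high+x t low low+x = <-irrefl refl (≤-trans low+x (≤-trans (m≤n+m x r) (≤-reflexive (sym [t+x]))))
    where
    r : ℕ
    r = t % (x + x)
    [t+x] : (t + x) % (x + x) ≡ r + x
    [t+x] = trans ([t+x]%2x t) (m<n⇒m%n≡m (+-monoˡ-< x low))

  high⇒low+x : ∀ t → ¬ Low t → Low (t + x)
  high⇒low+x t high = subst (_< x) (sym [t+x]) (+-cancelʳ-< x (r ∸ x) x r∸x+x<2x)
    where
    r : ℕ
    r = t % (x + x)
    x≤r : x ≤ r
    x≤r = ≮⇒≥ high
    r∸x+x<2x : r ∸ x + x < x + x
    r∸x+x<2x = subst (_< x + x) (sym (m∸n+n≡m x≤r)) (m%n<n t (x + x))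
    [t+x] : (t + x) % (x + x) ≡ r ∸ x
    [t+x] = begin
      (t + x) % (x + x)           ≡⟨ [t+x]%2x t ⟩
      (r + x) % (x + x)           ≡⟨ cong (λ z → (z + x) % (x + x)) (m∸n+n≡m x≤r) ⟨
      (r ∸ x + x + x) % (x + x)   ≡⟨ cong (_% (x + x)) (+-assoc (r ∸ x) x x) ⟩
      (r ∸ x + (x + x)) % (x + x) ≡⟨ [m+n]%n≡m%n (r ∸ x) (x + x) ⟩
      (r ∸ x) % (x + x)           ≡⟨ m<n⇒m%n≡m (≤-<-trans (m∸n≤m r x) (m%n<n t (x + x))) ⟩
      r ∸ x                       ∎
      where open ≡-Reasoning

  count-low-≥-half : ∀ D → D ≤ count D low? + count D low?
  count-low-≥-half D = begin
    D                                                    ≡⟨ count-complement low? D ⟨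
    count D low? + count D (¬? ∘ low?)                  ≤⟨ +-monoʳ-≤ (count D low?) high≤low ⟩
    count D low? + count D low?                          ∎
    where
    open ≤-Reasoning
    high⇒shifted-low : ∀ t → ¬ Low t → x ≤ t × Low (t ∸ x)
    high⇒shifted-low t high with x ≤? t
    ... | no x≰t = ⊥-elim (high (subst (_< x) (sym (m<n⇒m%n≡m (<-≤-trans t<x (m≤m+n x x)))) t<x))
      where
      t<x : t < x
      t<x = ≰⇒> x≰t
    ... | yes x≤t with low? (t ∸ x)
    ...   | yes low = x≤t , low
    ...   | no high′ = ⊥-elim (high (subst Low (m∸n+n≡m x≤t) (high⇒low+x (t ∸ x) high′)))
    high≤low : count D (¬? ∘ low?) ≤ count D low?
    high≤low = begin
      count D (¬? ∘ low?)                               ≤⟨ count-mono (¬? ∘ low?) shifted? D (λ t _ → high⇒shifted-low t) ⟩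
      count D shifted?                                  ≤⟨ sumBelow-extend _ (m≤m+n D x) ⟩
      count (D + x) shifted?                            ≡⟨ count-shift low? D x ⟩
      count D low?                                      ∎
      where
      shifted? : Decidable (λ t → x ≤ t × Low (t ∸ x))
      shifted? t = x ≤? t ×-dec low? (t ∸ x)

⌈n/2⌉≤1+⌊n/2⌋ : ∀ n → ⌈ n /2⌉ ≤ suc ⌊ n /2⌋
⌈n/2⌉≤1+⌊n/2⌋ zero = z≤n
⌈n/2⌉≤1+⌊n/2⌋ (suc zero) = ≤-refl
⌈n/2⌉≤1+⌊n/2⌋ (suc (suc n)) = s≤s (⌈n/2⌉≤1+⌊n/2⌋ n)

⌈n/2⌉≡⌊n/2⌋ : ∀ n → n % 2 ≡ 0 → ⌈ n /2⌉ ≡ ⌊ n /2⌋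
⌈n/2⌉≡⌊n/2⌋ zero _ = refl
⌈n/2⌉≡⌊n/2⌋ (suc (suc n)) n-even = cong suc (⌈n/2⌉≡⌊n/2⌋ n n-even)

⌈n/2⌉≡1+⌊n/2⌋ : ∀ n → n % 2 ≡ 1 → ⌈ n /2⌉ ≡ suc ⌊ n /2⌋
⌈n/2⌉≡1+⌊n/2⌋ (suc zero) _ = refl
⌈n/2⌉≡1+⌊n/2⌋ (suc (suc n)) n-odd = cong suc (⌈n/2⌉≡1+⌊n/2⌋ n n-odd)

m+m≤n+n⇒m≤n : ∀ {m n} → m + m ≤ n + n → m ≤ n
m+m≤n+n⇒m≤n {m} {n} m+m≤n+n with m ≤? n
... | yes m≤n = m≤n
... | no m≰n = contradiction m+m≤n+n (<⇒≱ (+-mono-< (≰⇒> m≰n) (≰⇒> m≰n)))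

m∸x+[2x∸m]≡x : ∀ {m x} → x ≤ m → m ≤ x + x → m ∸ x + (x + x ∸ m) ≡ x
m∸x+[2x∸m]≡x {m} {x} x≤m m≤2x = begin
  m ∸ x + (x + x ∸ m)               ≡⟨ cong (λ k → m ∸ x + (x + x ∸ k)) (m+[n∸m]≡n x≤m) ⟨
  m ∸ x + (x + x ∸ (x + (m ∸ x)))   ≡⟨ cong (m ∸ x +_) ([m+n]∸[m+o]≡n∸o x x (m ∸ x)) ⟩
  m ∸ x + (x ∸ (m ∸ x))             ≡⟨ m+[n∸m]≡n (m≤n+o⇒m∸n≤o m x m≤2x) ⟩
  x                                 ∎
  where open ≡-Reasoning

minimum : (A : List ℕ) → 0 < length A → Σ ℕ λ x → x ∈ A × All (x ≤_) A
minimum (a ∷ A) _ = min a A , argmin-all id (here refl) (All.tabulate there) , min≤⊤ a A ∷ min≤xs a A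

pairsWith : ℕ → List ℕ → List ℕ
pairsWith x = concatMap (λ y → y ∷ y + x ∷ [])

-- Pairwise disjoint pairs {y, y + x} ⊆ A ∖ {x}: Schur triples x + y = y + x in A through x.
record SchurPairs (A : List ℕ) (x : ℕ) : Set where
  field
    bases : List ℕ
    bases-∈ : All (λ y → y ∈ A × y + x ∈ A) bases
    distinct : Unique (x ∷ pairsWith x bases)

-- Counting colourings

punchOuts : ∀ {m} (k : Fin (suc m)) (l : List (Fin (suc m))) → All (k ≢_) l → List (Fin m)
punchOuts k [] [] = []
punchOuts k (i ∷ l) (k≢i ∷ k∉l) = punchOut k≢i ∷ punchOuts k l k∉l

length-punchOuts : ∀ {m} (k : Fin (suc m)) l k∉l → length (punchOuts k l k∉l) ≡ length l
length-punchOuts k [] [] = refl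
length-punchOuts k (i ∷ l) (_ ∷ k∉l) = cong suc (length-punchOuts k l k∉l)

punchOuts-∉ : ∀ {m} (k : Fin (suc m)) {j} (k≢j : k ≢ j) l k∉l → All (j ≢_) l → All (punchOut k≢j ≢_) (punchOuts k l k∉l)
punchOuts-∉ k k≢j [] [] [] = []
punchOuts-∉ k k≢j (i ∷ l) (k≢i ∷ k∉l) (j≢i ∷ j∉l) =
  (j≢i ∘ punchOut-injective k≢j k≢i) ∷ punchOuts-∉ k k≢j l k∉l j∉l

punchOuts-unique : ∀ {m} (k : Fin (suc m)) l k∉l → Unique l → Unique (punchOuts k l k∉l)
punchOuts-unique k [] [] [] = []
punchOuts-unique k (i ∷ l) (k≢i ∷ k∉l) (i∉l ∷ uniq) = punchOuts-∉ k k≢i l k∉l i∉l ∷ punchOuts-unique k l k∉l uniq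

lookup-insertAt-≢ : ∀ {A : Set} {m} (v : Vec A m) (k i : Fin (suc m)) a (k≢i : k ≢ i) →
                    lookup (insertAt v k a) i ≡ lookup v (punchOut k≢i)
lookup-insertAt-≢ v k i a k≢i =
  trans (cong (lookup (insertAt v k a)) (sym (punchIn-punchOut k≢i))) (insertAt-punchIn v k a (punchOut k≢i))

module Colourings (r : ℕ) where

  countVec : ∀ m → (Vec (Fin r) m → Bool) → ℕ
  countVec zero f = 𝟙 (f [])
  countVec (suc m) f = ∑[ c < r ] countVec m (f ∘ (c ∷_))

  countVec-cong : ∀ m {f f′ : Vec (Fin r) m → Bool} → (∀ v → f v ≡ f′ v) → countVec m f ≡ countVec m f′
  countVec-cong zero f≗f′ = cong 𝟙 (f≗f′ [])
  countVec-cong (suc m) f≗f′ = sum-cong-≗ {r} (λ c → countVec-cong m (λ v → f≗f′ (c ∷ v)))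

  countVec-mono : ∀ m {f f′ : Vec (Fin r) m → Bool} → (∀ v → T (f v) → T (f′ v)) → countVec m f ≤ countVec m f′
  countVec-mono zero f⇒f′ = 𝟙-mono (T? _) (T? _) (f⇒f′ [])
  countVec-mono (suc m) f⇒f′ = ∑-mono (λ c → countVec-mono m (λ v → f⇒f′ (c ∷ v)))

  countVec-≤ : ∀ m f → countVec m f ≤ r ^ m
  countVec-≤ zero f = 𝟙≤1 (f [])
  countVec-≤ (suc m) f = ≤-trans (∑-mono (λ c → countVec-≤ m (f ∘ (c ∷_)))) (≤-reflexive (∑-const r (r ^ m)))

  countVec-∧ : ∀ m b f → countVec m (λ v → b ∧ f v) ≡ 𝟙 b * countVec m f
  countVec-∧ m true f = sym (+-identityʳ _)
  countVec-∧ m false f = countVec-false m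
    where
    countVec-false : ∀ m → countVec m (λ _ → false) ≡ 0
    countVec-false zero = refl
    countVec-false (suc m) = trans (sum-cong-≗ {r} (λ _ → countVec-false m)) (trans (∑-const r 0) (*-zeroʳ r))

  countVec-insertAt : ∀ m (i : Fin (suc m)) f →
                      countVec (suc m) f ≡ ∑[ c < r ] countVec m (λ v → f (insertAt v i c))
  countVec-insertAt m zero f = refl
  countVec-insertAt (suc m) (suc i) f =
    trans (sum-cong-≗ {r} (λ d → countVec-insertAt m i (f ∘ (d ∷_)))) (∑-comm (λ d c → countVec m (λ v → f (d ∷ insertAt v i c))))

  length-filter-allVecs : ∀ m {P : Vec (Fin r) m → Set} (P? : Decidable P) →
                          length (filter P? (allVecs r m)) ≡ countVec m (does ∘ P?)
  length-filter-allVecs zero P? with does (P? [])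
  ... | true = refl
  ... | false = refl
  length-filter-allVecs (suc m) P? = length-filter-tabulate r id
    where
    length-filter-map-∷ : ∀ c (vs : List (Vec (Fin r) m)) →
                          length (filter P? (map (c ∷_) vs)) ≡ length (filter (P? ∘ (c ∷_)) vs)
    length-filter-map-∷ c [] = refl
    length-filter-map-∷ c (v ∷ vs) with does (P? (c ∷ v))
    ... | true = cong suc (length-filter-map-∷ c vs)
    ... | false = length-filter-map-∷ c vs
    length-filter-tabulate : ∀ n (f : Fin n → Fin r) →
         length (filter P? (concatMap (λ c → map (c ∷_) (allVecs r m)) (tabulate f)))
           ≡ ∑[ i < n ] countVec m (does ∘ P? ∘ (f i ∷_))
    length-filter-tabulate zero f = refl
    length-filter-tabulate (suc n) f = trans (cong length (filter-++ P? first _))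
                         (trans (length-++ (filter P? first))
                                (cong₂ _+_ (trans (length-filter-map-∷ (f zero) (allVecs r m))
                                                  (length-filter-allVecs m (P? ∘ (f zero ∷_))))
                                           (length-filter-tabulate n (f ∘ suc))))
      where
      first : List (Vec (Fin r) (suc m))
      first = map (f zero ∷_) (allVecs r m)

  g≡countVec : ∀ A → g A r ≡ countVec (length A) (does ∘ rainbowSumFree? A)
  g≡countVec A = length-filter-allVecs (length A) (rainbowSumFree? A)

  q : ℕ
  q = 3 * r ∸ 2

  notRainbow : Fin r → Fin r → Fin r → Bool
  notRainbow c a b = does (c ≟ᶠ a) ∨ does (c ≟ᶠ b) ∨ does (a ≟ᶠ b)

  ∑∑-notRainbow : 2 ≤ r → ∀ c → ∑[ a < r ] ∑[ b < r ] 𝟙 (notRainbow c a b) ≤ q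
  ∑∑-notRainbow 2≤r c = begin
    ∑[ a < r ] ∑[ b < r ] 𝟙 (notRainbow c a b)
      ≤⟨ ∑-mono row ⟩
    ∑[ a < r ] (2 + 𝟙 (does (c ≟ᶠ a)) * (r ∸ 2))
      ≡⟨ ∑-distrib-+ (λ _ → 2) (λ a → 𝟙 (does (c ≟ᶠ a)) * (r ∸ 2)) ⟩
    ∑[ a < r ] 2 + ∑[ a < r ] (𝟙 (does (c ≟ᶠ a)) * (r ∸ 2))
      ≡⟨ cong₂ _+_ (∑-const r 2) (sym (*-distribʳ-sum (r ∸ 2) (λ a → 𝟙 (does (c ≟ᶠ a))))) ⟩
    r * 2 + (∑[ a < r ] 𝟙 (does (c ≟ᶠ a))) * (r ∸ 2)
      ≡⟨ cong (λ k → r * 2 + k * (r ∸ 2)) (∑-𝟙-≟ᶠ c) ⟩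
    r * 2 + 1 * (r ∸ 2)
      ≡⟨ 2r+[r∸2]≡3r∸2 2≤r ⟩
    3 * r ∸ 2 ∎
    where
    open ≤-Reasoning
    2r+[r∸2]≡3r∸2 : ∀ {r} → 2 ≤ r → r * 2 + 1 * (r ∸ 2) ≡ 3 * r ∸ 2
    2r+[r∸2]≡3r∸2 {suc zero} (s≤s ())
    2r+[r∸2]≡3r∸2 {suc (suc k)} _ = identity k
      where
      identity : ∀ k → suc (suc k) * 2 + 1 * k ≡ k + (suc (suc k) + (suc (suc k) + 0))
      identity = solve-∀
    row : ∀ a → ∑[ b < r ] 𝟙 (notRainbow c a b) ≤ 2 + 𝟙 (does (c ≟ᶠ a)) * (r ∸ 2)
    row a with c ≟ᶠ a
    ... | yes refl = ≤-reflexive $ begin-equality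
      ∑[ b < r ] 1                      ≡⟨ ∑-const r 1 ⟩
      r * 1                             ≡⟨ *-identityʳ r ⟩
      r                                 ≡⟨ m+[n∸m]≡n 2≤r ⟨
      2 + (r ∸ 2)                       ≡⟨ cong (2 +_) (*-identityˡ (r ∸ 2)) ⟨
      2 + 1 * (r ∸ 2)                   ∎
    ... | no c≢a = begin
      ∑[ b < r ] 𝟙 (does (c ≟ᶠ b) ∨ does (a ≟ᶠ b))                ≤⟨ ∑-mono (λ b → 𝟙-∨-≤ (does (c ≟ᶠ b)) _) ⟩
      ∑[ b < r ] (𝟙 (does (c ≟ᶠ b)) + 𝟙 (does (a ≟ᶠ b)))          ≡⟨ ∑-distrib-+ (λ b → 𝟙 (does (c ≟ᶠ b))) _ ⟩
      ∑[ b < r ] 𝟙 (does (c ≟ᶠ b)) + ∑[ b < r ] 𝟙 (does (a ≟ᶠ b)) ≡⟨ cong₂ _+_ (∑-𝟙-≟ᶠ c) (∑-𝟙-≟ᶠ a) ⟩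
      2                                                              ≡⟨ +-identityʳ 2 ⟨
      2 + 0 * (r ∸ 2)                                                ∎

  notRainbow-complete : ∀ c a b → ¬ (c ≢ a × c ≢ b × a ≢ b) → T (notRainbow c a b)
  notRainbow-complete c a b ¬rainbow with c ≟ᶠ a | c ≟ᶠ b | a ≟ᶠ b
  ... | yes _ | _ | _ = tt
  ... | no _ | yes _ | _ = tt
  ... | no _ | no _ | yes _ = tt
  ... | no c≢a | no c≢b | no a≢b = ¬rainbow (c≢a , c≢b , a≢b)

  -- The positions are read in consecutive pairs (i₁ , j₁), (i₂ , j₂), …; a trailing odd position is ignored.
  pairsNotRainbow : ∀ {m} → Fin r → List (Fin m) → Vec (Fin r) m → Bool
  pairsNotRainbow c (i ∷ j ∷ l) v = notRainbow c (lookup v i) (lookup v j) ∧ pairsNotRainbow c l v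
  pairsNotRainbow c _ v = true

  pairsNotRainbow-insertAt : ∀ {m} c (k : Fin (suc m)) l k∉l (v : Vec (Fin r) m) a →
                             pairsNotRainbow c l (insertAt v k a) ≡ pairsNotRainbow c (punchOuts k l k∉l) v
  pairsNotRainbow-insertAt c k [] [] v a = refl
  pairsNotRainbow-insertAt c k (i ∷ []) (_ ∷ []) v a = refl
  pairsNotRainbow-insertAt c k (i ∷ j ∷ l) (k≢i ∷ k≢j ∷ k∉l) v a
    rewrite lookup-insertAt-≢ v k i a k≢i | lookup-insertAt-≢ v k j a k≢j
          | pairsNotRainbow-insertAt c k l k∉l v a = refl

  module _ {m} (c : Fin r) (i j : Fin (suc (suc m))) (i≢j : i ≢ j) (l : List (Fin (suc (suc m))))
           (i∉l : All (i ≢_) l) (j∉l : All (j ≢_) l) where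

    private
      j′ : Fin (suc m)
      j′ = punchOut i≢j
      l′ : List (Fin (suc m))
      l′ = punchOuts i l i∉l

    pairsRemoved : List (Fin m)
    pairsRemoved = punchOuts j′ l′ (punchOuts-∉ i i≢j l i∉l j∉l)

    length-pairsRemoved : length pairsRemoved ≡ length l
    length-pairsRemoved = trans (length-punchOuts j′ l′ _) (length-punchOuts i l i∉l)

    pairsRemoved-unique : Unique l → Unique pairsRemoved
    pairsRemoved-unique uniq = punchOuts-unique j′ l′ _ (punchOuts-unique i l i∉l uniq)

    countVec-pairsNotRainbow-∷∷ :
      countVec (suc (suc m)) (pairsNotRainbow c (i ∷ j ∷ l))
        ≡ (∑[ a < r ] ∑[ b < r ] 𝟙 (notRainbow c a b)) * countVec m (pairsNotRainbow c pairsRemoved)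
    countVec-pairsNotRainbow-∷∷ = begin
      countVec (suc (suc m)) (pairsNotRainbow c (i ∷ j ∷ l))
        ≡⟨ countVec-insertAt (suc m) i (pairsNotRainbow c (i ∷ j ∷ l)) ⟩
      ∑[ a < r ] countVec (suc m) (λ v → pairsNotRainbow c (i ∷ j ∷ l) (insertAt v i a))
        ≡⟨ sum-cong-≗ {r} (λ a → countVec-cong (suc m) (removeI a)) ⟩
      ∑[ a < r ] countVec (suc m) (λ v → notRainbow c a (lookup v j′) ∧ pairsNotRainbow c l′ v)
        ≡⟨ sum-cong-≗ {r} (λ a → countVec-insertAt m j′ (λ v → notRainbow c a (lookup v j′) ∧ pairsNotRainbow c l′ v)) ⟩
      ∑[ a < r ] ∑[ b < r ] countVec m (λ w → notRainbow c a (lookup (insertAt w j′ b) j′) ∧ pairsNotRainbow c l′ (insertAt w j′ b))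
        ≡⟨ sum-cong-≗ {r} (λ a → sum-cong-≗ {r} (λ b → countVec-cong m (removeJ a b))) ⟩
      ∑[ a < r ] ∑[ b < r ] countVec m (λ w → notRainbow c a b ∧ pairsNotRainbow c pairsRemoved w)
        ≡⟨ sum-cong-≗ {r} (λ a → sum-cong-≗ {r} (λ b → countVec-∧ m (notRainbow c a b) _)) ⟩
      ∑[ a < r ] ∑[ b < r ] (𝟙 (notRainbow c a b) * X)
        ≡⟨ sum-cong-≗ {r} (λ a → sym (*-distribʳ-sum X (λ b → 𝟙 (notRainbow c a b)))) ⟩
      ∑[ a < r ] ((∑[ b < r ] 𝟙 (notRainbow c a b)) * X)
        ≡⟨ sym (*-distribʳ-sum X (λ a → ∑[ b < r ] 𝟙 (notRainbow c a b))) ⟩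
      (∑[ a < r ] ∑[ b < r ] 𝟙 (notRainbow c a b)) * X
        ∎
      where
      open ≡-Reasoning
      X : ℕ
      X = countVec m (pairsNotRainbow c pairsRemoved)
      removeI : ∀ a v → pairsNotRainbow c (i ∷ j ∷ l) (insertAt v i a) ≡ notRainbow c a (lookup v j′) ∧ pairsNotRainbow c l′ v
      removeI a v rewrite insertAt-lookup v i a | lookup-insertAt-≢ v i j a i≢j
                        | pairsNotRainbow-insertAt c i l i∉l v a = refl
      removeJ : ∀ a b w → notRainbow c a (lookup (insertAt w j′ b) j′) ∧ pairsNotRainbow c l′ (insertAt w j′ b)
                          ≡ notRainbow c a b ∧ pairsNotRainbow c pairsRemoved w
      removeJ a b w rewrite insertAt-lookup w j′ b
                          | pairsNotRainbow-insertAt c j′ l′ (punchOuts-∉ i i≢j l i∉l j∉l) w b = refl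

  countVec-pairsNotRainbow : 2 ≤ r → ∀ m c (l : List (Fin m)) → Unique l →
    countVec m (pairsNotRainbow c l) * (r * r) ^ ⌊ length l /2⌋ ≤ r ^ m * q ^ ⌊ length l /2⌋
  countVec-pairsNotRainbow 2≤r m c [] _ = *-monoˡ-≤ 1 (countVec-≤ m _)
  countVec-pairsNotRainbow 2≤r m c (i ∷ []) _ = *-monoˡ-≤ 1 (countVec-≤ m _)
  countVec-pairsNotRainbow 2≤r (suc zero) c (zero ∷ zero ∷ l) ((i≢j ∷ _) ∷ _) = contradiction refl i≢j
  countVec-pairsNotRainbow 2≤r (suc (suc m)) c (i ∷ j ∷ l) ((i≢j ∷ i∉l) ∷ (j∉l ∷ uniq)) = begin
    countVec (suc (suc m)) (pairsNotRainbow c (i ∷ j ∷ l)) * ((r * r) * R)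
      ≡⟨ cong (_* ((r * r) * R)) (countVec-pairsNotRainbow-∷∷ c i j i≢j l i∉l j∉l) ⟩
    (S * X) * ((r * r) * R)   ≤⟨ *-monoˡ-≤ ((r * r) * R) (*-monoˡ-≤ X (∑∑-notRainbow 2≤r c)) ⟩
    (q * X) * ((r * r) * R)   ≡⟨ regroup q X (r * r) R ⟩
    (q * (r * r)) * (X * R)   ≤⟨ *-monoʳ-≤ (q * (r * r)) removed-bound ⟩
    (q * (r * r)) * (r ^ m * Q) ≡⟨ regroup′ q r (r ^ m) Q ⟩
    r ^ suc (suc m) * (q * Q) ∎
    where
    open ≤-Reasoning
    p R Q S X : ℕ
    p = ⌊ length l /2⌋
    R = (r * r) ^ p
    Q = q ^ p
    S = ∑[ a < r ] ∑[ b < r ] 𝟙 (notRainbow c a b)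
    X = countVec m (pairsNotRainbow c (pairsRemoved c i j i≢j l i∉l j∉l))
    removed-bound : X * R ≤ r ^ m * Q
    removed-bound = subst (λ k → X * (r * r) ^ ⌊ k /2⌋ ≤ r ^ m * q ^ ⌊ k /2⌋)
      (length-pairsRemoved c i j i≢j l i∉l j∉l)
      (countVec-pairsNotRainbow 2≤r m c _ (pairsRemoved-unique c i j i≢j l i∉l j∉l uniq))
    regroup : ∀ a b c d → (a * b) * (c * d) ≡ (a * c) * (b * d)
    regroup = solve-∀
    regroup′ : ∀ q r a b → (q * (r * r)) * (a * b) ≡ (r * (r * a)) * (q * b)
    regroup′ = solve-∀

  countVec-pairsNotRainbow-centred : 2 ≤ r → ∀ m (k : Fin m) (l : List (Fin m)) → All (k ≢_) l → Unique l →
    countVec m (λ v → pairsNotRainbow (lookup v k) l v) * (r * r) ^ ⌊ length l /2⌋ ≤ r ^ m * q ^ ⌊ length l /2⌋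
  countVec-pairsNotRainbow-centred 2≤r (suc m) k l k∉l uniq = begin
    countVec (suc m) (λ v → pairsNotRainbow (lookup v k) l v) * R
      ≡⟨ cong (_* R) (countVec-insertAt m k (λ v → pairsNotRainbow (lookup v k) l v)) ⟩
    (∑[ c < r ] countVec m (λ v → pairsNotRainbow (lookup (insertAt v k c) k) l (insertAt v k c))) * R
      ≡⟨ cong (_* R) (sum-cong-≗ {r} (λ c → countVec-cong m (removeK c))) ⟩
    (∑[ c < r ] countVec m (pairsNotRainbow c l′)) * R
      ≡⟨ *-distribʳ-sum R (λ c → countVec m (pairsNotRainbow c l′)) ⟩
    ∑[ c < r ] (countVec m (pairsNotRainbow c l′) * R)
      ≤⟨ ∑-mono (λ c → subst (λ k → countVec m (pairsNotRainbow c l′) * (r * r) ^ ⌊ k /2⌋ ≤ r ^ m * q ^ ⌊ k /2⌋)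
                            (length-punchOuts k l k∉l)
                            (countVec-pairsNotRainbow 2≤r m c l′ (punchOuts-unique k l k∉l uniq))) ⟩
    ∑[ c < r ] (r ^ m * Q)
      ≡⟨ ∑-const r (r ^ m * Q) ⟩
    r * (r ^ m * Q)
      ≡⟨ *-assoc r (r ^ m) Q ⟨
    r ^ suc m * Q ∎
    where
    open ≤-Reasoning
    R Q : ℕ
    R = (r * r) ^ ⌊ length l /2⌋
    Q = q ^ ⌊ length l /2⌋
    l′ : List (Fin m)
    l′ = punchOuts k l k∉l
    removeK : ∀ c v → pairsNotRainbow (lookup (insertAt v k c) k) l (insertAt v k c) ≡ pairsNotRainbow c l′ v
    removeK c v rewrite insertAt-lookup v k c = pairsNotRainbow-insertAt c k l k∉l v c

  module _ (A : List ℕ) (x : ℕ) where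

    positions : (ys : List ℕ) → All (λ y → y ∈ A × y + x ∈ A) ys → List (Fin (length A))
    positions [] [] = []
    positions (y ∷ ys) ((y∈A , y+x∈A) ∷ ys-∈) = index y∈A ∷ index y+x∈A ∷ positions ys ys-∈

    ⌊length-positions/2⌋ : ∀ ys ys-∈ → ⌊ length (positions ys ys-∈) /2⌋ ≡ length ys
    ⌊length-positions/2⌋ [] [] = refl
    ⌊length-positions/2⌋ (y ∷ ys) (_ ∷ ys-∈) = cong suc (⌊length-positions/2⌋ ys ys-∈)

    lookup-positions : ∀ ys ys-∈ → map (List.lookup A) (positions ys ys-∈) ≡ pairsWith x ys
    lookup-positions [] [] = refl
    lookup-positions (y ∷ ys) ((y∈A , y+x∈A) ∷ ys-∈) =
      cong₂ _∷_ (sym (lookup-index y∈A)) (cong₂ _∷_ (sym (lookup-index y+x∈A)) (lookup-positions ys ys-∈))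

    rainbowSumFree⇒pairsNotRainbow : (χ : Vec (Fin r) (length A)) (k : Fin (length A)) → List.lookup A k ≡ x →
      RainbowSumFree A χ → ∀ ys ys-∈ → Unique (x ∷ pairsWith x ys) → T (pairsNotRainbow (lookup χ k) (positions ys ys-∈) χ)
    rainbowSumFree⇒pairsNotRainbow χ k refl free [] [] _ = tt
    rainbowSumFree⇒pairsNotRainbow χ k refl free (y ∷ ys) ((y∈A , y+x∈A) ∷ ys-∈)
      ((x≢y ∷ x≢y+x ∷ x∉) ∷ (y≢y+x ∷ _) ∷ _ ∷ uniq) =
      Equivalence.from T-∧ (notRainbow-triple , rainbowSumFree⇒pairsNotRainbow χ k refl free ys ys-∈ (x∉ ∷ uniq))
      where
      i j : Fin (length A)
      i = index y∈A
      j = index y+x∈A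
      notRainbow-triple : T (notRainbow (lookup χ k) (lookup χ i) (lookup χ j))
      notRainbow-triple = notRainbow-complete _ _ _ λ (c≢a , c≢b , a≢b) →
        free (k , i , j , subst (_ ≢_) eᵢ x≢y , subst (_ ≢_) eⱼ x≢y+x , subst₂ _≢_ eᵢ eⱼ y≢y+x ,
              trans (cong (_ +_) (sym eᵢ)) (trans (+-comm _ y) eⱼ) , c≢a , c≢b , a≢b)
        where
        eᵢ : y ≡ List.lookup A i
        eᵢ = lookup-index y∈A
        eⱼ : y + List.lookup A k ≡ List.lookup A j
        eⱼ = lookup-index y+x∈A

  g-SchurPairs-bound : 2 ≤ r → ∀ {A x} → x ∈ A → (P : SchurPairs A x) → let p = length (SchurPairs.bases P) in
                 g A r * (r * r) ^ p ≤ r ^ length A * q ^ p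
  g-SchurPairs-bound 2≤r {A} {x} x∈A record { bases = ys ; bases-∈ = ys-∈ ; distinct = distinct } = begin
    g A r * (r * r) ^ length ys
      ≡⟨ cong (_* (r * r) ^ length ys) (g≡countVec A) ⟩
    countVec (length A) (does ∘ rainbowSumFree? A) * (r * r) ^ length ys
      ≤⟨ *-monoˡ-≤ ((r * r) ^ length ys) (countVec-mono (length A) (λ χ free →
           rainbowSumFree⇒pairsNotRainbow A x χ k (sym (lookup-index x∈A)) (does⇒ (rainbowSumFree? A χ) free) ys ys-∈ distinct)) ⟩
    countVec (length A) (λ v → pairsNotRainbow (lookup v k) l v) * (r * r) ^ length ys
      ≤⟨ subst (λ p → countVec (length A) (λ v → pairsNotRainbow (lookup v k) l v) * (r * r) ^ p ≤ r ^ length A * q ^ p)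
               (⌊length-positions/2⌋ A x ys ys-∈)
               (countVec-pairsNotRainbow-centred 2≤r (length A) k l k∉l l-unique) ⟩
    r ^ length A * q ^ length ys ∎
    where
    open ≤-Reasoning
    k : Fin (length A)
    k = index x∈A
    l : List (Fin (length A))
    l = positions A x ys ys-∈
    k∷l-unique : Unique (k ∷ l)
    k∷l-unique = Unique.map⁻ (subst Unique (sym (cong₂ _∷_ (sym (lookup-index x∈A)) (lookup-positions A x ys ys-∈))) distinct)
    k∉l : All (k ≢_) l
    k∉l = AllPairs.head k∷l-unique
    l-unique : Unique l
    l-unique = AllPairs.tail k∷l-unique
    does⇒ : ∀ {P : Set} (P? : Dec P) → T (does P?) → P
    does⇒ (yes p) _ = p

-- Schur pairs in large sets

module SeparatedWindow (n : ℕ) (A : List ℕ) {x : ℕ} {W : ℕ → Set} (W? : Decidable W)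
                       (W-range : ∀ {y} → W y → x < y × y + x ≤ n)
                       (W-separated : ∀ {y y′} → W y → W y′ → y ≢ y′ + x) where

  private
    N : ℕ
    N = suc n

  pairsWith-distinct : ∀ ys → All W ys → Unique ys → Unique (x ∷ pairsWith x ys)
  pairsWith-distinct ys Wys ys-unique = All-pairsWith ys (All.map x∉pair Wys) ∷ pairsWith-unique ys Wys ys-unique
    where
    All-pairsWith : ∀ {P : ℕ → Set} ys → All (λ y → P y × P (y + x)) ys → All P (pairsWith x ys)
    All-pairsWith [] [] = []
    All-pairsWith (y ∷ ys) ((Py , Py+x) ∷ Pys) = Py ∷ Py+x ∷ All-pairsWith ys Pys
    x∉pair : ∀ {y} → W y → x ≢ y × x ≢ y + x
    x∉pair Wy = <⇒≢ (proj₁ (W-range Wy)) , <⇒≢ (<-≤-trans (proj₁ (W-range Wy)) (m≤m+n _ x))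
    pairsWith-unique : ∀ ys → All W ys → Unique ys → Unique (pairsWith x ys)
    pairsWith-unique [] [] [] = []
    pairsWith-unique (y ∷ ys) (Wy ∷ Wys) (y∉ys ∷ ys-unique) =
      (W-separated Wy Wy ∷ All-pairsWith ys (All.zipWith y∉pair (y∉ys , Wys)))
      ∷ All-pairsWith ys (All.zipWith y+x∉pair (y∉ys , Wys))
      ∷ pairsWith-unique ys Wys ys-unique
      where
      y∉pair : ∀ {y′} → y ≢ y′ × W y′ → y ≢ y′ × y ≢ y′ + x
      y∉pair (y≢y′ , Wy′) = y≢y′ , W-separated Wy Wy′
      y+x∉pair : ∀ {y′} → y ≢ y′ × W y′ → y + x ≢ y′ × y + x ≢ y′ + x
      y+x∉pair (y≢y′ , Wy′) = W-separated Wy′ Wy ∘ sym , y≢y′ ∘ +-cancelʳ-≡ x y _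

  Base : ℕ → Set
  Base y = W y × y ∈ A × y + x ∈ A

  base? : Decidable Base
  base? y = W? y ×-dec y ∈? A ×-dec y + x ∈? A

  schurPairs : SchurPairs A x
  schurPairs = record
    { bases = filter base? (downFrom N)
    ; bases-∈ = All.map proj₂ (all-filter base? (downFrom N))
    ; distinct = pairsWith-distinct _ (All.map proj₁ (all-filter base? (downFrom N)))
                                      (Unique.filter⁺ base? (Unique.downFrom⁺ N))
    }

  pairs : ℕ
  pairs = length (SchurPairs.bases schurPairs)

  Shifted : ℕ → Set
  Shifted z = x ≤ z × W (z ∸ x)

  shifted? : Decidable Shifted
  shifted? z = x ≤? z ×-dec W? (z ∸ x)

  W∩A? : Decidable (λ y → W y × y ∈ A)
  W∩A? y = W? y ×-dec y ∈? A

  Shifted∩A? : Decidable (λ z → Shifted z × z ∈ A)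
  Shifted∩A? z = shifted? z ×-dec z ∈? A

  count-shifted : count N shifted? ≡ count N W?
  count-shifted = count-shift-< W? N x (s≤s ∘ proj₂ ∘ W-range)

  count-W∩A+count-Shifted∩A : count N W∩A? + count N Shifted∩A? ≤ pairs + count N W?
  count-W∩A+count-Shifted∩A = begin
    count N W∩A? + count N Shifted∩A?                         ≡⟨ cong (count N W∩A? +_) shifted∩A≡W∩[A-x] ⟩
    count N W∩A? + count N (λ y → W? y ×-dec y + x ∈? A)     ≤⟨ count-inclusion-exclusion W? (_∈? A) (λ y → y + x ∈? A) N ⟩
    count N base? + count N W?                                ≡⟨ cong (_+ count N W?) (length-filter-downFrom base? N) ⟨
    pairs + count N W?                                        ∎
    where
    open ≤-Reasoning
    unshift : ∀ {z} → (Shifted z × z ∈ A) ⇔ (x ≤ z × W (z ∸ x) × z ∸ x + x ∈ A)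
    unshift = mk⇔ (λ ((x≤z , Wz∸x) , z∈A) → x≤z , Wz∸x , subst (_∈ A) (sym (m∸n+n≡m x≤z)) z∈A)
                  (λ (x≤z , Wz∸x , z∈A) → (x≤z , Wz∸x) , subst (_∈ A) (m∸n+n≡m x≤z) z∈A)
    shifted∩A≡W∩[A-x] : count N Shifted∩A? ≡ count N (λ y → W? y ×-dec y + x ∈? A)
    shifted∩A≡W∩[A-x] =
      trans (count-cong Shifted∩A? (λ z → x ≤? z ×-dec W? (z ∸ x) ×-dec z ∸ x + x ∈? A) N (λ _ _ → unshift))
            (count-shift-< (λ y → W? y ×-dec y + x ∈? A) N x (s≤s ∘ proj₂ ∘ W-range ∘ proj₁))

module LargeSet (n : ℕ) {A C : List ℕ} {c : ℕ}
                (A-unique : Unique A) (A⊆[1,n] : InInterval 1 n A) (|A|≡⌈n/2⌉+c : length A ≡ ⌈ n /2⌉ + c) (0<c : 0 < c)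
                (lower⊆C : ∀ {y} → y ∈ A → y ≤ ⌊ n /2⌋ → y ∈ C) where

  private
    N fl h : ℕ
    N = suc n
    fl = ⌊ n /2⌋
    h = ⌈ n /2⌉

  fl+h≡n : fl + h ≡ n
  fl+h≡n = ⌊n/2⌋+⌈n/2⌉≡n n

  fl≤n : fl ≤ n
  fl≤n = subst (fl ≤_) fl+h≡n (m≤m+n fl h)

  fl+fl≤n : fl + fl ≤ n
  fl+fl≤n = subst (fl + fl ≤_) fl+h≡n (+-monoʳ-≤ fl (⌊n/2⌋≤⌈n/2⌉ n))

  count-A : count N (_∈? A) ≡ length A
  count-A = count-∈ N A-unique (All.map (s≤s ∘ proj₂) A⊆[1,n])

  lower-A upper-A missing : ℕ
  lower-A = count N (λ y → y ≤? fl ×-dec y ∈? A)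
  upper-A = count N (λ y → ¬? (y ≤? fl) ×-dec y ∈? A)
  missing = count N (λ y → ¬? (y ≤? fl) ×-dec ¬? (y ∈? A))

  upper-A+missing≡h : upper-A + missing ≡ h
  upper-A+missing≡h = begin
    upper-A + missing
      ≡⟨ cong₂ _+_ (count-cong (λ y → ¬? (y ≤? fl) ×-dec y ∈? A) (λ y → y ∈? A ×-dec ¬? (y ≤? fl)) N
                               (λ _ _ → ×-comm))
                   (count-cong (λ y → ¬? (y ≤? fl) ×-dec ¬? (y ∈? A)) (λ y → ¬? (y ∈? A) ×-dec ¬? (y ≤? fl)) N
                               (λ _ _ → ×-comm)) ⟩
    count N (λ y → y ∈? A ×-dec ¬? (y ≤? fl)) + count N (λ y → ¬? (y ∈? A) ×-dec ¬? (y ≤? fl))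
      ≡⟨ count-partition (λ y → ¬? (y ≤? fl)) (_∈? A) N ⟨
    count N (λ y → ¬? (y ≤? fl))
      ≡⟨ count-cong (λ y → ¬? (y ≤? fl)) (λ y → suc fl ≤? y ×-dec y <? N) N
                    (λ _ y<N → mk⇔ (λ y≰fl → ≰⇒> y≰fl , y<N) (<⇒≱ ∘ proj₁)) ⟩
    count N (λ y → suc fl ≤? y ×-dec y <? N)
      ≡⟨ count-interval-≤ N (suc fl) N ≤-refl ⟩
    n ∸ fl
      ≡⟨ cong (_∸ fl) fl+h≡n ⟨
    fl + h ∸ fl
      ≡⟨ m+n∸m≡n fl h ⟩
    h ∎
    where
    open ≡-Reasoning
    ×-comm : ∀ {P Q : Set} → (P × Q) ⇔ (Q × P)
    ×-comm = mk⇔ swap swap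

  lower-A≡c+missing : lower-A ≡ c + missing
  lower-A≡c+missing = +-cancelʳ-≡ upper-A lower-A (c + missing) $ begin
    lower-A + upper-A       ≡⟨ count-partition (_∈? A) (_≤? fl) N ⟨
    count N (_∈? A)         ≡⟨ count-A ⟩
    length A                ≡⟨ |A|≡⌈n/2⌉+c ⟩
    h + c                   ≡⟨ cong (_+ c) upper-A+missing≡h ⟨
    upper-A + missing + c   ≡⟨ regroup upper-A missing c ⟩
    c + missing + upper-A   ∎
    where
    open ≡-Reasoning
    regroup : ∀ u m c → u + m + c ≡ c + m + u
    regroup = solve-∀

  c+missing≤|C| : c + missing ≤ length C
  c+missing≤|C| = subst (_≤ length C) lower-A≡c+missing
    (≤-trans (count-mono (λ y → y ≤? fl ×-dec y ∈? A) (_∈? C) N (λ _ _ (y≤fl , y∈A) → lower⊆C y∈A y≤fl))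
             (count-∈-≤ N C))

  private
    A-minimum : Σ ℕ λ x → x ∈ A × All (x ≤_) A
    A-minimum = minimum A (subst (0 <_) (sym |A|≡⌈n/2⌉+c) (≤-trans 0<c (m≤n+m c h)))

  x : ℕ
  x = proj₁ A-minimum

  x∈A : x ∈ A
  x∈A = proj₁ (proj₂ A-minimum)

  x≤A : All (x ≤_) A
  x≤A = proj₂ (proj₂ A-minimum)

  0<x : 0 < x
  0<x = proj₁ (All.lookup A⊆[1,n] x∈A)

  x≤n : x ≤ n
  x≤n = proj₂ (All.lookup A⊆[1,n] x∈A)

  x+c≤1+fl : x + c ≤ suc fl
  x+c≤1+fl = subst (_≤ suc fl) (+-comm c x) (m≤o∸n⇒m+n≤o c x≤1+fl c≤1+fl∸x)
    where
    c≤1+fl∸x : c ≤ suc fl ∸ x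
    c≤1+fl∸x = begin
      c                                           ≤⟨ m≤m+n c missing ⟩
      c + missing                                 ≡⟨ lower-A≡c+missing ⟨
      lower-A                                     ≤⟨ count-mono (λ y → y ≤? fl ×-dec y ∈? A) (λ y → x ≤? y ×-dec y <? suc fl) N
                                                       (λ _ _ (y≤fl , y∈A) → All.lookup x≤A y∈A , s≤s y≤fl) ⟩
      count N (λ y → x ≤? y ×-dec y <? suc fl)  ≡⟨ count-interval-≤ N x (suc fl) (s≤s fl≤n) ⟩
      suc fl ∸ x                                  ∎
      where open ≤-Reasoning
    x≤1+fl : x ≤ suc fl
    x≤1+fl with x ≤? suc fl
    ... | yes x≤1+fl = x≤1+fl
    ... | no x≰1+fl = contradiction (subst (c ≤_) (m≤n⇒m∸n≡0 (<⇒≤ (≰⇒> x≰1+fl))) c≤1+fl∸x) (<⇒≱ 0<c)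

  x≤fl : x ≤ fl
  x≤fl = ≤-pred (subst (_≤ suc fl) (+-comm x 1) (≤-trans (+-monoʳ-≤ x 0<c) x+c≤1+fl))

  x+x≤n : x + x ≤ n
  x+x≤n = ≤-trans (+-mono-≤ x≤fl x≤fl) fl+fl≤n

  ManySchurPairs : Set
  ManySchurPairs = Σ (SchurPairs A x) λ P → h + (c + c) ≤ length (SchurPairs.bases P) + fl + 2

  module _ (n≤3x : n ≤ x + x + x) where

    private
      m : ℕ
      m = n ∸ x

      W : ℕ → Set
      W y = suc x ≤ y × y < suc m

      W? : Decidable W
      W? y = suc x ≤? y ×-dec y <? suc m

      Gap : ℕ → Set
      Gap y = suc m ≤ y × y < suc (x + x)

      gap? : Decidable Gap
      gap? y = suc m ≤? y ×-dec y <? suc (x + x)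

      m≤2x : m ≤ x + x
      m≤2x = subst (m ≤_) (m+n∸n≡m (x + x) x) (∸-monoˡ-≤ x n≤3x)

      W-range : ∀ {y} → W y → x < y × y + x ≤ n
      W-range {y} (x<y , y≤m) = x<y , subst (y + x ≤_) (m∸n+n≡m x≤n) (+-monoˡ-≤ x (≤-pred y≤m))

      W-separated : ∀ {y y′} → W y → W y′ → y ≢ y′ + x
      W-separated (_ , y≤m) (x<y′ , _) refl = <⇒≱ (+-monoˡ-< x x<y′) (≤-trans (≤-pred y≤m) m≤2x)

    open SeparatedWindow n A W? W-range W-separated

    private
      covered : ∀ y → y < N → y ∈ A → y ≡ x ⊎ (W y × y ∈ A) ⊎ (Shifted y × y ∈ A) ⊎ Gap y
      covered y y<N y∈A with y ≟ x | y ≤? m | y ≤? x + x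
      ... | yes y≡x | _ | _ = inj₁ y≡x
      ... | no y≢x | yes y≤m | _ = inj₂ (inj₁ ((≤∧≢⇒< (All.lookup x≤A y∈A) (y≢x ∘ sym) , s≤s y≤m) , y∈A))
      ... | no _ | no y≰m | yes y≤2x = inj₂ (inj₂ (inj₂ (≰⇒> y≰m , s≤s y≤2x)))
      ... | no _ | no _ | no y≰2x = inj₂ (inj₂ (inj₁ ((All.lookup x≤A y∈A , x<y∸x , s≤s y∸x≤m) , y∈A)))
        where
        x<y∸x : x < y ∸ x
        x<y∸x = m+n≤o⇒m≤o∸n (suc x) (≰⇒> y≰2x)
        y∸x≤m : y ∸ x ≤ m
        y∸x≤m = ∸-monoˡ-≤ x (≤-pred y<N)

    |A|≤pairs+x+1 : length A ≤ pairs + x + 1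
    |A|≤pairs+x+1 = begin
      length A
        ≡⟨ count-A ⟨
      count N (_∈? A)
        ≤⟨ count-mono (_∈? A) pieces? N covered ⟩
      count N pieces?
        ≤⟨ count-⊎ (_≟ x) rest? N ⟩
      count N (_≟ x) + count N rest?
        ≤⟨ +-mono-≤ (count-singleton-≤1 N x) (count-⊎ W∩A? shifted-or-gap? N) ⟩
      1 + (count N W∩A? + count N shifted-or-gap?)
        ≤⟨ +-monoʳ-≤ 1 (+-monoʳ-≤ (count N W∩A?) (count-⊎ Shifted∩A? gap? N)) ⟩
      1 + (count N W∩A? + (count N Shifted∩A? + count N gap?))
        ≡⟨ cong (1 +_) (+-assoc (count N W∩A?) (count N Shifted∩A?) (count N gap?)) ⟨
      1 + ((count N W∩A? + count N Shifted∩A?) + count N gap?)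
        ≤⟨ +-monoʳ-≤ 1 (+-monoˡ-≤ (count N gap?) count-W∩A+count-Shifted∩A) ⟩
      1 + ((pairs + count N W?) + count N gap?)
        ≡⟨ cong (1 +_) (+-assoc pairs (count N W?) (count N gap?)) ⟩
      1 + (pairs + (count N W? + count N gap?))
        ≡⟨ cong (λ k → 1 + (pairs + k)) (cong₂ _+_ |W| |Gap|) ⟩
      1 + (pairs + (m ∸ x + (x + x ∸ m)))
        ≡⟨ cong (λ k → 1 + (pairs + k)) (m∸x+[2x∸m]≡x (m+n≤o⇒m≤o∸n x x+x≤n) m≤2x) ⟩
      1 + (pairs + x)
        ≡⟨ +-comm 1 (pairs + x) ⟩
      pairs + x + 1 ∎
      where
      open ≤-Reasoning
      shifted-or-gap? : Decidable (λ y → (Shifted y × y ∈ A) ⊎ Gap y)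
      shifted-or-gap? y = Shifted∩A? y ⊎-dec gap? y
      rest? : Decidable (λ y → (W y × y ∈ A) ⊎ (Shifted y × y ∈ A) ⊎ Gap y)
      rest? y = W∩A? y ⊎-dec shifted-or-gap? y
      pieces? : Decidable (λ y → y ≡ x ⊎ (W y × y ∈ A) ⊎ (Shifted y × y ∈ A) ⊎ Gap y)
      pieces? y = y ≟ x ⊎-dec rest? y
      |W| : count N W? ≡ m ∸ x
      |W| = count-interval-≤ N (suc x) (suc m) (s≤s (m∸n≤m n x))
      |Gap| : count N gap? ≡ x + x ∸ m
      |Gap| = count-interval-≤ N (suc m) (suc (x + x)) (s≤s x+x≤n)

    manySchurPairs-large-x : ManySchurPairs
    manySchurPairs-large-x = schurPairs , (begin
      h + (c + c)             ≡⟨ +-assoc h c c ⟨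
      h + c + c               ≡⟨ cong (_+ c) |A|≡⌈n/2⌉+c ⟨
      length A + c            ≤⟨ +-monoˡ-≤ c |A|≤pairs+x+1 ⟩
      pairs + x + 1 + c       ≡⟨ regroup pairs x c ⟩
      pairs + (x + c) + 1     ≤⟨ +-monoˡ-≤ 1 (+-monoʳ-≤ pairs x+c≤1+fl) ⟩
      pairs + suc fl + 1      ≡⟨ regroup′ pairs fl ⟩
      pairs + fl + 2          ∎)
      where
      open ≤-Reasoning
      regroup : ∀ p x c → p + x + 1 + c ≡ p + (x + c) + 1
      regroup = solve-∀
      regroup′ : ∀ p f → p + suc f + 1 ≡ p + f + 2
      regroup′ = solve-∀

  module _ (3x<n : x + x + x < n) (100|C|≤n : 100 * length C ≤ n) where

    private
      s m : ℕ
      s = suc fl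
      m = n ∸ x

    open LowerHalf x 0<x

    private
      -- Every other block of x consecutive integers above ⌊n/2⌋.
      W : ℕ → Set
      W y = (s ≤ y × y < suc m) × Low (y ∸ s)

      W? : Decidable W
      W? y = (s ≤? y ×-dec y <? suc m) ×-dec low? (y ∸ s)

      W-range : ∀ {y} → W y → x < y × y + x ≤ n
      W-range {y} ((s≤y , y≤m) , _) = <-≤-trans (s≤s x≤fl) s≤y , subst (y + x ≤_) (m∸n+n≡m x≤n) (+-monoˡ-≤ x (≤-pred y≤m))

      W-separated : ∀ {y y′} → W y → W y′ → y ≢ y′ + x
      W-separated {_} {y′} (_ , low) ((s≤y′ , _) , low′) refl =
        low⇒high+x (y′ ∸ s) low′ (subst Low (+-∸-comm x s≤y′) low)

    open SeparatedWindow n A W? W-range W-separated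

    private
      count-upper-≤ : ∀ {V : ℕ → Set} (V? : Decidable V) → (∀ {y} → V y → fl < y) →
                      count N V? ≤ count N (λ y → V? y ×-dec y ∈? A) + missing
      count-upper-≤ {V} V? V-upper = begin
        count N V?                                                                   ≡⟨ count-partition V? (_∈? A) N ⟩
        count N (λ y → y ∈? A ×-dec V? y) + count N (λ y → ¬? (y ∈? A) ×-dec V? y)
          ≤⟨ +-mono-≤ (≤-reflexive (count-cong (λ y → y ∈? A ×-dec V? y) (λ y → V? y ×-dec y ∈? A) N (λ _ _ → mk⇔ swap swap)))
                      (count-mono (λ y → ¬? (y ∈? A) ×-dec V? y) (λ y → ¬? (y ≤? fl) ×-dec ¬? (y ∈? A)) N
                                  (λ _ _ (y∉A , Vy) → <⇒≱ (V-upper Vy) , y∉A)) ⟩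
        count N (λ y → V? y ×-dec y ∈? A) + missing                                  ∎
        where open ≤-Reasoning

      |W|≤pairs+2missing : count N W? ≤ pairs + (missing + missing)
      |W|≤pairs+2missing = +-cancelˡ-≤ (count N W?) (count N W?) _ $ begin
        count N W? + count N W?
          ≤⟨ +-mono-≤ (count-upper-≤ W? (λ ((s≤y , _) , _) → s≤y))
                      (≤-trans (≤-reflexive (sym count-shifted)) (count-upper-≤ shifted? shifted-upper)) ⟩
        (count N W∩A? + missing) + (count N Shifted∩A? + missing)
          ≡⟨ interchange (count N W∩A?) missing (count N Shifted∩A?) missing ⟩
        (count N W∩A? + count N Shifted∩A?) + (missing + missing)
          ≤⟨ +-monoˡ-≤ (missing + missing) count-W∩A+count-Shifted∩A ⟩
        (pairs + count N W?) + (missing + missing)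
          ≡⟨ regroup pairs (count N W?) (missing + missing) ⟩
        count N W? + (pairs + (missing + missing)) ∎
        where
        open ≤-Reasoning
        shifted-upper : ∀ {z} → Shifted z → fl < z
        shifted-upper {z} (x≤z , (s≤z∸x , _) , _) = ≤-trans s≤z∸x (m∸n≤m z x)
        regroup : ∀ p w k → (p + w) + k ≡ w + (p + k)
        regroup = solve-∀

      fl≤m : fl ≤ m
      fl≤m = m+n≤o⇒m≤o∸n fl (≤-trans (+-monoʳ-≤ fl x≤fl) fl+fl≤n)

      m∸fl≤|W|+|W| : m ∸ fl ≤ count N W? + count N W?
      m∸fl≤|W|+|W| = ≤-trans (count-low-≥-half (m ∸ fl)) (+-mono-≤ |low|≤|W| |low|≤|W|)
        where
        m∸fl+s≡1+m : m ∸ fl + s ≡ suc m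
        m∸fl+s≡1+m = trans (+-suc (m ∸ fl) fl) (cong suc (m∸n+n≡m fl≤m))
        |low|≤|W| : count (m ∸ fl) low? ≤ count N W?
        |low|≤|W| = begin
          count (m ∸ fl) low?
            ≡⟨ count-shift low? (m ∸ fl) s ⟨
          count (m ∸ fl + s) (λ z → s ≤? z ×-dec low? (z ∸ s))
            ≤⟨ count-mono (λ z → s ≤? z ×-dec low? (z ∸ s)) W? (m ∸ fl + s)
                          (λ z z<m∸fl+s (s≤z , low) → (s≤z , subst (z <_) m∸fl+s≡1+m z<m∸fl+s) , low) ⟩
          count (m ∸ fl + s) W?
            ≤⟨ sumBelow-extend _ (subst (_≤ N) (sym m∸fl+s≡1+m) (s≤s (m∸n≤m n x))) ⟩
          count N W? ∎
          where open ≤-Reasoning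

      4|C|≤m∸fl : (length C + length C) + (length C + length C) ≤ m ∸ fl
      4|C|≤m∸fl = m+n≤o⇒m≤o∸n _ (m+n≤o⇒m≤o∸n _ (*-cancelˡ-≤ 6 six-fold))
        where
        open ≤-Reasoning
        e : ℕ
        e = length C
        expand : ∀ e f x → 6 * ((e + e) + (e + e) + f + x) ≡ 24 * e + 3 * (f + f) + 2 * (x + x + x)
        expand = solve-∀
        collect : ∀ n → n + 3 * n + 2 * n ≡ 6 * n
        collect = solve-∀
        six-fold : 6 * ((e + e) + (e + e) + fl + x) ≤ 6 * n
        six-fold = begin
          6 * ((e + e) + (e + e) + fl + x)          ≡⟨ expand e fl x ⟩
          24 * e + 3 * (fl + fl) + 2 * (x + x + x)  ≤⟨ +-mono-≤ (+-mono-≤ (≤-trans (*-monoˡ-≤ e (m≤m+n 24 76)) 100|C|≤n)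
                                                                           (*-monoʳ-≤ 3 fl+fl≤n))
                                                                 (*-monoʳ-≤ 2 (<⇒≤ 3x<n)) ⟩
          n + 3 * n + 2 * n                         ≡⟨ collect n ⟩
          6 * n                                     ∎

      c+c≤pairs : c + c ≤ pairs
      c+c≤pairs = +-cancelʳ-≤ (missing + missing) (c + c) pairs $ begin
        (c + c) + (missing + missing)   ≡⟨ interchange c c missing missing ⟩
        (c + missing) + (c + missing)   ≤⟨ +-mono-≤ c+missing≤|C| c+missing≤|C| ⟩
        length C + length C             ≤⟨ m+m≤n+n⇒m≤n (≤-trans 4|C|≤m∸fl m∸fl≤|W|+|W|) ⟩
        count N W?                      ≤⟨ |W|≤pairs+2missing ⟩
        pairs + (missing + missing)     ∎
        where open ≤-Reasoning

    manySchurPairs-small-x : ManySchurPairs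
    manySchurPairs-small-x = schurPairs , (begin
      h + (c + c)             ≤⟨ +-mono-≤ (⌈n/2⌉≤1+⌊n/2⌋ n) c+c≤pairs ⟩
      suc fl + pairs          ≡⟨ regroup fl pairs ⟩
      pairs + fl + 1          ≤⟨ +-monoʳ-≤ (pairs + fl) (n≤1+n 1) ⟩
      pairs + fl + 2          ∎)
      where
      open ≤-Reasoning
      regroup : ∀ f p → suc f + p ≡ p + f + 1
      regroup = solve-∀

  manySchurPairs : 100 * length C ≤ n → ManySchurPairs
  manySchurPairs 100|C|≤n with n ≤? x + x + x
  ... | yes n≤3x = manySchurPairs-large-x n≤3x
  ... | no n≰3x = manySchurPairs-small-x (≰⇒> n≰3x) 100|C|≤n

-- Numerical estimates

^-distribʳ-* : ∀ m n o → (m * n) ^ o ≡ m ^ o * n ^ o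
^-distribʳ-* m n zero = refl
^-distribʳ-* m n (suc o) rewrite ^-distribʳ-* m n o = *-interchange m n (m ^ o) (n ^ o)

[3r∸2]²<r³ : ∀ {r} → 8 ≤ r → (3 * r ∸ 2) * (3 * r ∸ 2) < r * (r * r)
[3r∸2]²<r³ {r} 8≤r = subst (λ r → (3 * r ∸ 2) * (3 * r ∸ 2) < r * (r * r)) (m+[n∸m]≡n 8≤r) (shifted (r ∸ 8))
  where
  expand : ∀ k → (6 + k + (8 + k + (8 + k + 0))) * (6 + k + (8 + k + (8 + k + 0))) + suc (27 + 60 * k + 15 * (k * k) + k * (k * k))
                 ≡ (8 + k) * ((8 + k) * (8 + k))
  expand = solve-∀
  shifted : ∀ k → (3 * (8 + k) ∸ 2) * (3 * (8 + k) ∸ 2) < (8 + k) * ((8 + k) * (8 + k))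
  shifted k = subst ((3 * (8 + k) ∸ 2) * (3 * (8 + k) ∸ 2) <_) (expand k) (m<m+n _ z<s)

≤-lower-exponent : ∀ {R Q T P} g M → Q ≤ R → .{{NonZero R}} → T ≤ P → g * R ^ P ≤ M * Q ^ P → g * R ^ T ≤ M * Q ^ T
≤-lower-exponent {R} {Q} {T} {P} g M Q≤R T≤P bound = *-cancelʳ-≤ (g * R ^ T) (M * Q ^ T) (R ^ u) {{m^n≢0 R u}} $ begin
  g * R ^ T * R ^ u   ≡⟨ *-assoc g (R ^ T) (R ^ u) ⟩
  g * (R ^ T * R ^ u) ≡⟨ cong (g *_) (^-distribˡ-+-* R T u) ⟨
  g * R ^ (T + u)     ≡⟨ cong (λ e → g * R ^ e) T+u≡P ⟩
  g * R ^ P           ≤⟨ bound ⟩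
  M * Q ^ P           ≡⟨ cong (λ e → M * Q ^ e) T+u≡P ⟨
  M * Q ^ (T + u)     ≡⟨ cong (M *_) (^-distribˡ-+-* Q T u) ⟩
  M * (Q ^ T * Q ^ u) ≡⟨ *-assoc M (Q ^ T) (Q ^ u) ⟨
  M * Q ^ T * Q ^ u   ≤⟨ *-monoʳ-≤ (M * Q ^ T) (^-monoˡ-≤ u Q≤R) ⟩
  M * Q ^ T * R ^ u   ∎
  where
  open ≤-Reasoning
  u : ℕ
  u = P ∸ T
  T+u≡P : T + u ≡ P
  T+u≡P = m+[n∸m]≡n T≤P

r^d*q^2d<[r*r]^2d : ∀ {r q d} .{{_ : NonZero r}} .{{_ : NonZero d}} → q * q < r * (r * r) →
                    r ^ d * q ^ (d + d) < (r * r) ^ (d + d)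
r^d*q^2d<[r*r]^2d {r} {q} {d} q²<r³ = begin-strict
  r ^ d * q ^ (d + d)           ≡⟨ cong (r ^ d *_) (^-distribˡ-+-* q d d) ⟩
  r ^ d * (q ^ d * q ^ d)       ≡⟨ cong (r ^ d *_) (^-distribʳ-* q q d) ⟨
  r ^ d * (q * q) ^ d           <⟨ *-monoʳ-< (r ^ d) {{m^n≢0 r d}} (^-monoˡ-< d q²<r³) ⟩
  r ^ d * (r * (r * r)) ^ d     ≡⟨ ^-distribʳ-* r (r * (r * r)) d ⟨
  (r * (r * (r * r))) ^ d       ≡⟨ cong (_^ d) (*-assoc r r (r * r)) ⟨
  ((r * r) * (r * r)) ^ d       ≡⟨ ^-distribʳ-* (r * r) (r * r) d ⟩
  (r * r) ^ d * (r * r) ^ d     ≡⟨ ^-distribˡ-+-* (r * r) d d ⟨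
  (r * r) ^ (d + d)             ∎
  where open ≤-Reasoning

module _ {r : ℕ} (8≤r : 8 ≤ r) where

  private
    q : ℕ
    q = 3 * r ∸ 2

    instance
      r≢0 : NonZero r
      r≢0 = >-nonZero (≤-trans z<s 8≤r)
      r*r≢0 : NonZero (r * r)
      r*r≢0 = m*n≢0 r r
      q≢0 : NonZero q
      q≢0 = >-nonZero (≤-trans (s≤s z≤n) (∸-monoˡ-≤ 2 (*-monoʳ-≤ 3 8≤r)))

    q≤r*r : q ≤ r * r
    q≤r*r = ≤-trans (m∸n≤m (3 * r) 2) (*-monoˡ-≤ r (≤-trans (s≤s (s≤s (s≤s z≤n))) 8≤r))

    key : ∀ d .{{_ : NonZero d}} → r ^ d * q ^ (d + d) < (r * r) ^ (d + d)
    key d = r^d*q^2d<[r*r]^2d {r} {q} {d} ([3r∸2]²<r³ 8≤r)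

  even-bound : ∀ {g h d P} .{{_ : NonZero d}} → d + d ≤ P → g * (r * r) ^ P ≤ r ^ (h + suc d) * q ^ P →
               g < r ^ (h + 1)
  even-bound {g} {h} {d} {P} 2d≤P bound = *-cancelʳ-< ((r * r) ^ (d + d)) g (r ^ (h + 1)) $ begin-strict
    g * (r * r) ^ (d + d)              ≤⟨ ≤-lower-exponent g (r ^ (h + suc d)) q≤r*r 2d≤P bound ⟩
    r ^ (h + suc d) * q ^ (d + d)      ≡⟨ cong (λ e → r ^ e * q ^ (d + d)) (+-assoc h 1 d) ⟨
    r ^ (h + 1 + d) * q ^ (d + d)      ≡⟨ cong (_* q ^ (d + d)) (^-distribˡ-+-* r (h + 1) d) ⟩
    r ^ (h + 1) * r ^ d * q ^ (d + d)  ≡⟨ *-assoc (r ^ (h + 1)) (r ^ d) (q ^ (d + d)) ⟩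
    r ^ (h + 1) * (r ^ d * q ^ (d + d)) <⟨ *-monoʳ-< (r ^ (h + 1)) {{m^n≢0 r (h + 1)}} (key d) ⟩
    r ^ (h + 1) * (r * r) ^ (d + d)    ∎
    where open ≤-Reasoning

  odd-bound : ∀ {g h d P} .{{_ : NonZero d}} → suc (d + d) ≤ P → g * (r * r) ^ P ≤ r ^ (h + suc d) * q ^ P →
              g * r < r ^ h * q
  odd-bound {g} {h} {d} {P} 2d+1≤P bound = *-cancelʳ-< ((r * r) ^ suc (d + d)) (g * r) (r ^ h * q) $ begin-strict
    g * r * (r * r) ^ suc (d + d)                     ≡⟨ *-right-comm g r _ ⟩
    g * (r * r) ^ suc (d + d) * r                     ≤⟨ *-monoˡ-≤ r (≤-lower-exponent g (r ^ (h + suc d)) q≤r*r 2d+1≤P bound) ⟩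
    r ^ (h + suc d) * (q * q ^ (d + d)) * r           ≡⟨ cong (λ x → x * (q * q ^ (d + d)) * r) (^-distribˡ-+-* r h (suc d)) ⟩
    r ^ h * (r * r ^ d) * (q * q ^ (d + d)) * r       ≡⟨ regroup (r ^ h) r (r ^ d) q (q ^ (d + d)) ⟩
    (r ^ h * q) * ((r * r) * (r ^ d * q ^ (d + d)))  <⟨ *-monoʳ-< (r ^ h * q) {{m*n≢0 (r ^ h) q {{m^n≢0 r h}}}}
                                                          (*-monoʳ-< (r * r) (key d)) ⟩
    (r ^ h * q) * ((r * r) * (r * r) ^ (d + d))      ∎
    where
    open ≤-Reasoning
    regroup : ∀ a r b q c → a * (r * b) * (q * c) * r ≡ (a * q) * ((r * r) * (b * c))
    regroup = solve-∀

even⇒2d≤pairs : ∀ {n d p} → n % 2 ≡ 0 → ⌈ n /2⌉ + (suc d + suc d) ≤ p + ⌊ n /2⌋ + 2 → d + d ≤ p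
even⇒2d≤pairs {n} {d} {p} n-even bound =
  +-cancelʳ-≤ 2 (d + d) p (+-cancelˡ-≤ ⌊ n /2⌋ _ _ (subst₂ _≤_ lhs (rhs p ⌊ n /2⌋) bound))
  where
  regroup : ∀ f d → f + (suc d + suc d) ≡ f + (d + d + 2)
  regroup = solve-∀
  lhs : ⌈ n /2⌉ + (suc d + suc d) ≡ ⌊ n /2⌋ + (d + d + 2)
  lhs = trans (cong (_+ (suc d + suc d)) (⌈n/2⌉≡⌊n/2⌋ n n-even)) (regroup ⌊ n /2⌋ d)
  rhs : ∀ p f → p + f + 2 ≡ f + (p + 2)
  rhs = solve-∀

odd⇒2d+1≤pairs : ∀ {n d p} → n % 2 ≡ 1 → ⌈ n /2⌉ + (suc d + suc d) ≤ p + ⌊ n /2⌋ + 2 → suc (d + d) ≤ p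
odd⇒2d+1≤pairs {n} {d} {p} n-odd bound =
  +-cancelʳ-≤ 2 (suc (d + d)) p (+-cancelˡ-≤ ⌊ n /2⌋ _ _ (subst₂ _≤_ lhs (rhs p ⌊ n /2⌋) bound))
  where
  regroup : ∀ f d → suc f + (suc d + suc d) ≡ f + (suc (d + d) + 2)
  regroup = solve-∀
  lhs : ⌈ n /2⌉ + (suc d + suc d) ≡ ⌊ n /2⌋ + (suc (d + d) + 2)
  lhs = trans (cong (_+ (suc d + suc d)) (⌈n/2⌉≡1+⌊n/2⌋ n n-odd)) (regroup ⌊ n /2⌋ d)
  rhs : ∀ p f → p + f + 2 ≡ f + (p + 2)
  rhs = solve-∀

rainbowSumFree-bound : ∀ {r n d A C} → 8 ≤ r → 0 < d → Unique A → InInterval 1 n A → length A ≡ ⌈ n /2⌉ + suc d →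
  100 * length C ≤ n → (∀ {y} → y ∈ A → y ≤ ⌊ n /2⌋ → y ∈ C) →
  (n % 2 ≡ 0 → g A r < r ^ (⌈ n /2⌉ + 1)) × (n % 2 ≡ 1 → g A r * r < r ^ ⌈ n /2⌉ * (3 * r ∸ 2))
rainbowSumFree-bound {r} {n} {d} {A} 8≤r 0<d A-unique A⊆[1,n] |A|≡ 100|C|≤n lower⊆C =
  (λ n-even → even-bound 8≤r {g A r} {⌈ n /2⌉} (even⇒2d≤pairs {n} n-even size) colourings) ,
  (λ n-odd → odd-bound 8≤r {g A r} {⌈ n /2⌉} (odd⇒2d+1≤pairs {n} n-odd size) colourings)
  where
  open LargeSet n A-unique A⊆[1,n] |A|≡ z<s lower⊆C
  instance
    d≢0 : NonZero d
    d≢0 = >-nonZero 0<d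
  P : SchurPairs A x
  P = proj₁ (manySchurPairs 100|C|≤n)
  p : ℕ
  p = length (SchurPairs.bases P)
  size : ⌈ n /2⌉ + (suc d + suc d) ≤ p + ⌊ n /2⌋ + 2
  size = proj₂ (manySchurPairs 100|C|≤n)
  colourings : g A r * (r * r) ^ p ≤ r ^ (⌈ n /2⌉ + suc d) * (3 * r ∸ 2) ^ p
  colourings = subst (λ k → g A r * (r * r) ^ p ≤ r ^ k * (3 * r ∸ 2) ^ p) |A|≡
                     (Colourings.g-SchurPairs-bound r (≤-trans (s≤s (s≤s z≤n)) 8≤r) x∈A P)

-- Opened only here: the integer sign +_ would make the sections (m +_) above ambiguous.
open import Data.Nat.Coprimality using (1-coprimeTo)
import Data.Nat.Coprimality as Coprime
open import Data.Integer using (+_)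
import Data.Integer as ℤ
import Data.Integer.Properties as ℤ
open import Data.Rational using (ℚ; mkℚ; 0ℚ; _/_) renaming (_≤_ to _≤ℚ_; _<_ to _<ℚ_; _*_ to _*ℚ_)
import Data.Rational as ℚ
open import Data.Rational.Properties using (normalize-coprime; normalize-nonNeg; toℚᵘ-mono-≤; toℚᵘ-homo-*; *-monoʳ-≤-nonNeg)
import Data.Rational.Properties as ℚ
import Data.Rational.Unnormalised as ℚᵘ
import Data.Rational.Unnormalised.Properties as ℚᵘ

n/1≡mkℚ : ∀ n → + n / 1 ≡ mkℚ (+ n) 0 (Coprime.sym (1-coprimeTo n))
n/1≡mkℚ n = normalize-coprime (Coprime.sym (1-coprimeTo n))

0<1/100 : 0ℚ <ℚ + 1 / 100
0<1/100 = ℚ.*<* (ℤ.+<+ (s≤s z≤n))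

≤1/100*⇒100*≤ : ∀ {ε} e n → ε ≤ℚ + 1 / 100 → + e / 1 ≤ℚ ε *ℚ (+ n / 1) → 100 * e ≤ n
≤1/100*⇒100*≤ {ε} e n ε≤1/100 e≤εn =
  subst (_≤ n) (*-comm e 100) (ℤ.drop‿+≤+ (subst₂ ℤ._≤_ (sym (ℤ.pos-* e 100)) (trans (ℤ.*-identityʳ _) (ℤ.*-identityˡ (+ n)))
                                                      (ℚᵘ.drop-*≤* unnormalised)))
  where
  instance
    n/1≥0 : ℚ.NonNegative (+ n / 1)
    n/1≥0 = normalize-nonNeg n 1
  e≤n/100 : + e / 1 ≤ℚ (+ 1 / 100) *ℚ (+ n / 1)
  e≤n/100 = ℚ.≤-trans e≤εn (*-monoʳ-≤-nonNeg (+ n / 1) ε≤1/100)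
  unnormalised : ℚᵘ.mkℚᵘ (+ e) 0 ℚᵘ.≤ ℚᵘ.mkℚᵘ (+ 1) 99 ℚᵘ.* ℚᵘ.mkℚᵘ (+ n) 0
  unnormalised = ℚᵘ.≤-respʳ-≃ (toℚᵘ-homo-* (+ 1 / 100) (mkℚ (+ n) 0 (Coprime.sym (1-coprimeTo n))))
                   (toℚᵘ-mono-≤ (subst₂ (λ a b → a ≤ℚ (+ 1 / 100) *ℚ b) (n/1≡mkℚ e) (n/1≡mkℚ n) e≤n/100))

mainTheorem19 :
    Σ ℚ λ ε₀ → (0ℚ <ℚ ε₀) ×
      ((ε : ℚ) → 0ℚ <ℚ ε → ε ≤ℚ ε₀ →
       (r : ℕ) → 8 ≤ r → (n : ℕ) → 1 ≤ n →
       (A B C : List ℕ) → Unique A → InInterval 1 n A →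
       (c : ℕ) → length A ≡ ⌈ n /2⌉ + c → 1 < c → (+ c / 1) ≤ℚ ε *ℚ (+ n / 1) →
       A ↭ B ++ C → InInterval (⌊ n /2⌋ + 1) n B →
       (+ length C / 1) ≤ℚ ε *ℚ (+ n / 1) →
       (n % 2 ≡ 0 → g A r < r ^ (⌈ n /2⌉ + 1)) ×
       (n % 2 ≡ 1 → g A r * r < r ^ ⌈ n /2⌉ * (3 * r ∸ 2)))
mainTheorem19 = + 1 / 100 , 0<1/100 ,
  λ { ε _ ε≤1/100 r 8≤r n _ A B C A-unique A⊆[1,n] (suc d) |A|≡ (s≤s 0<d) _ A↭B++C B⊆upper |C|≤εn →
      rainbowSumFree-bound 8≤r 0<d A-unique A⊆[1,n] |A|≡ (≤1/100*⇒100*≤ (length C) n ε≤1/100 |C|≤εn) (lower⊆C A↭B++C B⊆upper) }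
  where
  lower⊆C : ∀ {n A B C} → A ↭ B ++ C → InInterval (⌊ n /2⌋ + 1) n B → ∀ {y} → y ∈ A → y ≤ ⌊ n /2⌋ → y ∈ C
  lower⊆C {n} {B = B} A↭B++C B⊆upper {y} y∈A y≤fl with ∈-++⁻ B (∈-resp-↭ A↭B++C y∈A)
  ... | inj₁ y∈B = contradiction (subst (_≤ y) (+-comm ⌊ n /2⌋ 1) (proj₁ (All.lookup B⊆upper y∈B))) (<⇒≱ (s≤s y≤fl))
  ... | inj₂ y∈C = y∈C
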